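{- Let $\mathbf P$ be a matroid property that is stable under isomorphism, closed under direct sums, and inherited by connected components (if $\mathsf M$ has $\mathbf P$ then each connected component of $\mathsf M$ has $\mathbf P$). Then $\mathcal M^{\mathbf P,\mathrm{disc}}_\bullet=\mathcal M^{\mathbf P}_+\star\mathcal M^{\mathbf P}_+$. Moreover, if in addition either ($\mathbf P$ is deletion closed and every matroid with $\mathbf P$ is loopless) or ($\mathbf P$ is contraction closed and every matroid with $\mathbf P$ is coloopless), then the connected quotient is identified with the indecomposable quotient: $\mathcal M^{\mathbf P,\mathrm{cont}}_\bullet\cong\mathcal M^{\mathbf P}_+/(\mathcal M^{\mathbf P}_+\star\mathcal M^{\mathbf P}_+)$.
   Context: Matroids have finite ground set $E(\mathsf M)$. A matroid is connected if it is nonempty and not a direct sum of two nonempty matroids; disconnected otherwise (for nonempty matroids). An orientation of $\mathsf M$ is a generator $\eta$ of $\bigwedge^{|E|}\mathbb{Z}\langle E\rangle$, $E=E(\mathsf M)$. $\mathcal M$ is the $\mathbb{Q}$-vector space spanned by symbols $[\mathsf M,\eta]$ modulo $[\mathsf M,-\eta]=-[\mathsf M,\eta]$ and $[\mathsf M,\eta]=[\mathsf M',\psi_*\eta]$ for every matroid isomorphism $\psi:\mathsf M\to\mathsf M'$ ($\psi_*$ the induced map on top exterior powers), graded by ground-set size ($\mathcal M_\bullet$). The product is $[\mathsf M,\eta]\star[\mathsf Q,\omega]=[\mathsf M\oplus\mathsf Q,\eta\wedge\omega]$. For a property $\mathbf P$ stable under isomorphism, $\mathcal M^{\mathbf P}_\bullet$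 is the span of classes $[\mathsf M,\eta]$ with $\mathsf M$ having $\mathbf P$; $\mathcal M^{\mathbf P}_+$ is its part of positive degree (ground set nonempty); $\mathcal M^{\mathbf P,\mathrm{disc}}_\bullet$ is the span of classes $[\mathsf M,\eta]\in\mathcal M^{\mathbf P}_\bullet$ with $\mathsf M$ disconnected; and $\mathcal M^{\mathbf P,\mathrm{cont}}_\bullet=\mathcal M^{\mathbf P}_\bullet/\mathcal M^{\mathbf P,\mathrm{disc}}_\bullet$. Deletion closed (resp. contraction closed) means $\mathsf M\setminus x$ (resp. $\mathsf M/x$) has $\mathbf P$ whenever $\mathsf M$ does, for all $x\in E(\mathsf M)$. Under the additional hypotheses, $\mathcal M^{\mathbf P,\mathrm{disc}}_\bullet$ is a subcomplex for the deletion differential $\partial_{\mathrm{del}}[\mathsf M,\eta]=\sum_{x\text{ not a coloop}}[\mathsf M\setminus x,\iota_x\eta]$ (resp. the contraction differential $\partial_{\mathrm{con}}[\mathsf M,\eta]=\sum_{x\text{ not a loop}}[\mathsf M/x,\iota_x\eta]$), where $\iota_x$ is interior product. -}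

module Defs where

open import Data.Nat as ℕ using (ℕ; zero; suc; _<_)
open import Data.Fin as Fin using (Fin; zero; suc; toℕ; _↑ˡ_; _↑ʳ_; punchOut)
open import Data.Fin.Permutation using (Permutation′; _⟨$⟩ʳ_)
open import Data.Bool using (Bool; true; false; _∧_; _∨_; not; if_then_else_)
open import Data.Rational as ℚ using (ℚ; 0ℚ; 1ℚ)
open import Data.List using (List; []; _∷_; _++_; map; concatMap; foldr; allFin; filter)
open import Data.List.Relation.Unary.All using (All)
open import Data.Product using (Σ; ∃; _×_; _,_; proj₁; proj₂)
open import Data.Sum using (_⊎_)
open import Relation.Nullary using (¬_; does; yes; no)
open import Relation.Binary.PropositionalEquality using (_≡_; refl)
open import Function.Definitions using (Injective)

-- A matroid on a ground set of size n is
-- taken on the canonical ground set Fin n (every matroid is isomorphic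
-- to one of these); subsets are Bool-valued indicator functions.

Sub : ℕ → Set
Sub n = Fin n → Bool

∅ₛ : ∀ {n} → Sub n
∅ₛ _ = false

_∩ₛ_ : ∀ {n} → Sub n → Sub n → Sub n
(S ∩ₛ T) i = S i ∧ T i

_∖ₛ_ : ∀ {n} → Sub n → Sub n → Sub n
(S ∖ₛ T) i = S i ∧ not (T i)

_⊆ₛ_ : ∀ {n} → Sub n → Sub n → Set
T ⊆ₛ S = ∀ i → T i ≡ true → S i ≡ true

single : ∀ {n} → Fin n → Sub n
single x i = does (x Fin.≟ i)

addₛ : ∀ {n} → Sub n → Fin n → Sub n
addₛ S x i = S i ∨ does (x Fin.≟ i)

card : ∀ {n} → Sub n → ℕ
card {zero}  S = 0
card {suc n} S = (if S zero then 1 else 0) ℕ.+ card (λ i → S (suc i))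

anyF : ∀ {k} → (Fin k → Bool) → Bool
anyF {zero}  f = false
anyF {suc k} f = f zero ∨ anyF (λ i → f (suc i))

allSubsets : (n : ℕ) → List (Sub n)
allSubsets zero = (λ ()) ∷ []
allSubsets (suc n) =
  concatMap (λ S → (λ { zero → false ; (suc i) → S i })
                 ∷ (λ { zero → true ; (suc i) → S i }) ∷ []) (allSubsets n)

allL : ∀ {A : Set} → (A → Bool) → List A → Bool
allL p = foldr (λ a b → p a ∧ b) true

RawMat : ℕ → Set
RawMat n = Sub n → Bool      -- independence oracle

record IsMatroid {n : ℕ} (M : RawMat n) : Set where
  field
    empty-indep : M ∅ₛ ≡ true
    hereditary  : ∀ S T → T ⊆ₛ S → M S ≡ true → M T ≡ true
    augment     : ∀ I J → M I ≡ true → M J ≡ true → card I < card J →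
                  Σ (Fin n) λ j → J j ≡ true × I j ≡ false × M (addₛ I j) ≡ true

-- Isomorphic copy along a permutation σ (ψ = σ : E(M) → E(M')):
-- S independent in M  iff  σ(S) independent in σ·M.
permute : ∀ {n} → Permutation′ n → RawMat n → RawMat n
permute σ M T = M (λ i → T (σ ⟨$⟩ʳ i))

_⊕_ : ∀ {m n} → RawMat m → RawMat n → RawMat (m ℕ.+ n)
_⊕_ {m} {n} M Q S = M (λ i → S (i ↑ˡ n)) ∧ Q (λ j → S (m ↑ʳ j))

IsSeparator : ∀ {n} → RawMat n → Sub n → Set
IsSeparator M A = ∀ S → M S ≡ (M (S ∩ₛ A) ∧ M (S ∖ₛ A))

Disconnected : ∀ {n} → RawMat n → Set
Disconnected {n} M =
  Σ (Sub n) λ A → (∃ λ i → A i ≡ true) × (∃ λ i → A i ≡ false) × IsSeparator M A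

Connected : ∀ {n} → RawMat n → Set
Connected {n} M = 0 < n × ¬ Disconnected M

image : ∀ {k n} → (Fin k → Fin n) → Sub k → Sub n
image f T j = anyF (λ i → T i ∧ does (f i Fin.≟ j))

restrict : ∀ {k n} → RawMat n → (Fin k → Fin n) → RawMat k
restrict M f T = M (image f T)

IsComponent : ∀ {k n} → RawMat n → (Fin k → Fin n) → Set
IsComponent M f = IsSeparator M (image f (λ _ → true)) × Connected (restrict M f)

isLoop : ∀ {n} → RawMat n → Fin n → Bool
isLoop M x = not (M (single x))

isColoop : ∀ {n} → RawMat n → Fin n → Bool
isColoop {n} M x = allL (λ S → not (M S) ∨ M (addₛ S x)) (allSubsets n)

-- T ⊆ Fin n viewed inside Fin (suc n) ∖ {x} (via punchIn x), plus b at x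
insAt : ∀ {n} → Fin (suc n) → Bool → Sub n → Sub (suc n)
insAt x b T j with x Fin.≟ j
... | yes _  = b
... | no x≢j = T (punchOut x≢j)

delete : ∀ {n} → RawMat (suc n) → Fin (suc n) → RawMat n
delete M x T = M (insAt x false T)

contract : ∀ {n} → RawMat (suc n) → Fin (suc n) → RawMat n
contract M x T = if isLoop M x then M (insAt x false T) else M (insAt x true T)

-- A class [M, η] with E = Fin n is written ±[M], where
-- [M] := [M, e₀ ∧ … ∧ e_{n-1}] (this builds in [M,-η] = -[M,η]).
-- Elements of the free ℚ-space on symbols are formal combinations.

Sym : Set
Sym = Σ ℕ RawMat

FC : Set
FC = List (ℚ × Sym)

⟦_⟧ : Sym → FC
⟦ s ⟧ = (1ℚ , s) ∷ []

scale : ℚ → FC → FC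
scale q = map (λ p → (q ℚ.* proj₁ p , proj₂ p))

_−F_ : FC → FC → FC
v −F w = v ++ scale (ℚ.- 1ℚ) w

symEq : Sym → Sym → Bool
symEq (m , M) (n , N) with m ℕ.≟ n
... | yes refl = allL (λ S → does (Data.Bool._≟_ (M S) (N S))) (allSubsets m)
  where import Data.Bool
... | no _ = false

coeff : Sym → FC → ℚ
coeff s = foldr (λ p acc → (if symEq s (proj₂ p) then proj₁ p else 0ℚ) ℚ.+ acc) 0ℚ

_≈F_ : FC → FC → Set
v ≈F w = ∀ s → coeff s v ≡ coeff s w

InSpan : (FC → Set) → FC → Set
InSpan G v = Σ (List (ℚ × FC)) λ xs →
  All (λ p → G (proj₂ p)) xs × v ≈F concatMap (λ p → scale (proj₁ p) (proj₂ p)) xs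

_∪G_ : (FC → Set) → (FC → Set) → (FC → Set)
(G ∪G H) v = G v ⊎ H v

sgn : ∀ {n} → Permutation′ n → ℚ
sgn {n} σ = foldr (λ i acc → foldr (λ j acc′ →
      if does (toℕ i ℕ.<? toℕ j) ∧ does (toℕ (σ ⟨$⟩ʳ j) ℕ.<? toℕ (σ ⟨$⟩ʳ i))
      then ℚ.- acc′ else acc′) acc (allFin n)) 1ℚ (allFin n)

-- relations [M, η] = [σ·M, σ_* η], i.e. [M] − sgn(σ)[σ·M]
Rel : FC → Set
Rel v = Σ ℕ λ n → Σ (RawMat n) λ M → IsMatroid M × Σ (Permutation′ n) λ σ →
  v ≡ ((1ℚ , (n , M)) ∷ (ℚ.- sgn σ , (n , permute σ M)) ∷ [])

-- v lies in the subspace of 𝓜 spanned by (the classes of) G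
InSub : (FC → Set) → FC → Set
InSub G v = InSpan (G ∪G Rel) v

SameSub : (FC → Set) → (FC → Set) → Set
SameSub G H = (∀ v → G v → InSub H v) × (∀ v → H v → InSub G v)

Property : Set₁
Property = ∀ {n} → RawMat n → Set

IsoStable : Property → Set
IsoStable P = ∀ {n} (M : RawMat n) (σ : Permutation′ n) → IsMatroid M → P M → P (permute σ M)

SumClosed : Property → Set
SumClosed P = ∀ {m n} (M : RawMat m) (Q : RawMat n) →
  IsMatroid M → IsMatroid Q → P M → P Q → P (M ⊕ Q)

ComponentInherited : Property → Set
ComponentInherited P = ∀ {n k} (M : RawMat n) (f : Fin k → Fin n) →
  IsMatroid M → P M → Injective _≡_ _≡_ f → IsComponent M f → P (restrict M f)

DeletionClosed : Property → Set
DeletionClosed P = ∀ {n} (M : RawMat (suc n)) → IsMatroid M → P M → ∀ x → P (delete M x)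

ContractionClosed : Property → Set
ContractionClosed P = ∀ {n} (M : RawMat (suc n)) → IsMatroid M → P M → ∀ x → P (contract M x)

Loopless : Property → Set
Loopless P = ∀ {n} (M : RawMat n) → IsMatroid M → P M → ∀ x → isLoop M x ≡ false

Coloopless : Property → Set
Coloopless P = ∀ {n} (M : RawMat n) → IsMatroid M → P M → ∀ x → isColoop M x ≡ false

GenP : Property → FC → Set
GenP P v = Σ ℕ λ n → Σ (RawMat n) λ M → IsMatroid M × P M × v ≡ ⟦ n , M ⟧

GenP+ : Property → FC → Set
GenP+ P v = Σ ℕ λ n → Σ (RawMat (suc n)) λ M → IsMatroid M × P M × v ≡ ⟦ suc n , M ⟧

GenP0 : Property → FC → Set
GenP0 P v = Σ (RawMat 0) λ M → IsMatroid M × P M × v ≡ ⟦ 0 , M ⟧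

GenDisc : Property → FC → Set
GenDisc P v = Σ ℕ λ n → Σ (RawMat n) λ M →
  IsMatroid M × P M × Disconnected M × v ≡ ⟦ n , M ⟧

-- generators of 𝓜^P_+ ⋆ 𝓜^P_+ : [M, η] ⋆ [Q, ω] = [M ⊕ Q, η ∧ ω]
GenProd : Property → FC → Set
GenProd P v = Σ ℕ λ m → Σ ℕ λ n → Σ (RawMat (suc m)) λ M → Σ (RawMat (suc n)) λ Q →
  IsMatroid M × P M × IsMatroid Q × P Q × v ≡ ⟦ suc m ℕ.+ suc n , M ⊕ Q ⟧

-- Differentials on formal combinations.
-- ι_x (e₀ ∧ … ∧ e_n) = (-1)^x e₀ ∧ … ê_x … ∧ e_n, and E ∖ x ≅ Fin n order-preservingly.

signF : ∀ {n} → Fin n → ℚ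
signF zero    = 1ℚ
signF (suc i) = ℚ.- signF i

∂delSym : ℚ → Sym → FC
∂delSym q (zero , M)  = []
∂delSym q (suc n , M) =
  concatMap (λ x → if isColoop M x then [] else ((q ℚ.* signF x , (n , delete M x)) ∷ []))
            (allFin (suc n))

∂conSym : ℚ → Sym → FC
∂conSym q (zero , M)  = []
∂conSym q (suc n , M) =
  concatMap (λ x → if isLoop M x then [] else ((q ℚ.* signF x , (n , contract M x)) ∷ []))
            (allFin (suc n))

∂del : FC → FC
∂del = concatMap (λ p → ∂delSym (proj₁ p) (proj₂ p))

∂con : FC → FC
∂con = concatMap (λ p → ∂conSym (proj₁ p) (proj₂ p))

-- "𝓜^{P,cont}_• is identified (as a complex, via the map induced by
-- 𝓜^P_+ ⊆ 𝓜^P_•) with 𝓜^P_+ / (𝓜^P_+ ⋆ 𝓜^P_+)" for the differential d: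
Identified : Property → (FC → FC) → Set
Identified P d =
    -- 𝓜^P_+ is a subcomplex
    (∀ v → GenP+ P v → InSub (GenP+ P) (d v))
    -- 𝓜^P_+ ⋆ 𝓜^P_+ is a subcomplex, so the indecomposable quotient is a complex
  × (∀ v → GenProd P v → InSub (GenProd P) (d v))
    -- 𝓜^{P,disc} is a subcomplex, so the connected quotient is a complex
  × (∀ v → GenDisc P v → InSub (GenDisc P) (d v))
    -- the induced map 𝓜^P_+/(𝓜^P_+⋆𝓜^P_+) → 𝓜^{P,cont}_• is well defined
  × (∀ v → InSub (GenP+ P) v → InSub (GenProd P) v → InSub (GenDisc P) v)
    -- ... injective
  × (∀ v → InSub (GenP+ P) v → InSub (GenDisc P) v → InSub (GenProd P) v)
    -- ... and onto 𝓜^{P,cont} in every positive degree (everything is hit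
    -- modulo the degree-0 part)
  × (∀ v → InSub (GenP P) v → Σ FC λ w → InSub (GenP+ P) w ×
        InSub (GenDisc P ∪G GenP0 P) (v −F w))

{-# OPTIONS --safe #-}

-- A separator of a disconnected matroid M splits it into two nonempty pieces; splitting every
-- disconnected piece again, by induction on its size, ends in connected components of M, which
-- have P.  Reassembling, M becomes after a relabelling σ of its ground set a sum Q₁ ⊕ Q₂ of two
-- nonempty direct sums of components, both with P by sum-closure, and the relation
-- [M] = sgn σ · [σ·M] puts [M] into 𝓜^P_+ ⋆ 𝓜^P_+; conversely every such sum is disconnected.
-- For the differentials, an independent non-coloop x of a disconnected matroid lies on a side of
-- a separator together with some other element, so that side survives deleting or contracting x
-- and the minor stays disconnected.  Looplessness (resp. colooplessness) makes every term of
-- ∂del (resp. ∂con) of this kind and kills ∂ of one-element matroids, so no degree 0 appears.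
-- The remaining parts of the identification are formal once the two subspaces agree.

module Submission where

open import Defs
open import Algebra.Bundles using (CommutativeMonoid)
open import Data.Bool as Bool using (Bool; true; false; _∧_; _∨_; not; if_then_else_)
import Data.Bool.Properties as Boolₚ
open import Data.Empty using (⊥-elim)
open import Data.Fin as Fin using (Fin; zero; suc; _↑ˡ_; _↑ʳ_; punchIn; punchOut; splitAt)
import Data.Fin.Properties as Finₚ
open import Data.Fin.Permutation using (Permutation′)
open import Data.Fin.Subset.Properties using (anySubset?)
open import Data.List using (List; []; _∷_; _++_; map; concatMap; allFin)
open import Data.List.Properties using (concatMap-++; ++-assoc)
open import Data.List.Relation.Unary.All using (All; []; _∷_)
import Data.List.Relation.Unary.All.Properties as Allₚ
open import Data.Nat as ℕ using (ℕ; zero; suc; _<_; z≤n; s≤s)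
open import Data.Nat.Induction using (<-wellFounded)
import Data.Nat.Properties as ℕₚ
open import Data.Product as Product using (Σ; ∃; _×_; _,_; proj₁; proj₂)
open import Data.Rational as ℚ using (ℚ; 0ℚ; 1ℚ)
import Data.Rational.Properties as ℚₚ
open import Data.Rational.Solver using (module +-*-Solver)
open import Data.Sum using (_⊎_; inj₁; inj₂)
open import Data.Vec using (lookup; tabulate)
open import Data.Vec.Properties using (lookup∘tabulate)
open import Data.Vec.Functional using () renaming (_++_ to _++ᶠ_)
import Data.Vec.Functional.Properties as Vecᶠₚ
open import Function using (_∘_; _on_; id)
open import Function.Bundles using (mk⇔; mk↔ₛ′)
open import Function.Definitions using (Injective)
open import Induction.WellFounded using (WfRec; module All)
import Relation.Binary.Construct.On as On
open import Relation.Nullary using (¬_; ¬?; Dec; does; yes; no)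
open import Relation.Nullary.Decidable
  using (dec-true; dec-false; does-⇔; map′; decidable-stable; _×-dec_)
open import Algebra.Properties.CommutativeSemigroup
  (CommutativeMonoid.commutativeSemigroup Boolₚ.∨-commutativeMonoid) using (xy∙z≈xz∙y)
open import Relation.Binary.PropositionalEquality


-- Booleans and images of subsets

bool-ext : ∀ {a b : Bool} → (a ≡ true → b ≡ true) → (b ≡ true → a ≡ true) → a ≡ b
bool-ext {false} {false} _   _   = refl
bool-ext {false} {true}  _   b⇒a = b⇒a refl
bool-ext {true}  {false} a⇒b _   = sym (a⇒b refl)
bool-ext {true}  {true}  _   _   = refl

∧-elimˡ : ∀ {a b} → a ∧ b ≡ true → a ≡ true
∧-elimˡ {true} _ = refl

∧-elimʳ : ∀ {a b} → a ∧ b ≡ true → b ≡ true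
∧-elimʳ {true} p = p

∧-intro : ∀ {a b} → a ≡ true → b ≡ true → a ∧ b ≡ true
∧-intro refl refl = refl

∨-elim : ∀ {a b} → a ∨ b ≡ true → a ≡ true ⊎ b ≡ true
∨-elim {true}  _ = inj₁ refl
∨-elim {false} p = inj₂ p

∨-introˡ : ∀ {a b} → a ≡ true → a ∨ b ≡ true
∨-introˡ refl = refl

∨-introʳ : ∀ {a b} → b ≡ true → a ∨ b ≡ true
∨-introʳ {a} refl = Boolₚ.∨-zeroʳ a

≟⇒≡ : ∀ {n} {x y : Fin n} → does (x Fin.≟ y) ≡ true → x ≡ y
≟⇒≡ {x = x} {y} p with x Fin.≟ y
≟⇒≡ _  | yes x≡y = x≡y
≟⇒≡ () | no _

≟-refl : ∀ {n} (x : Fin n) → does (x Fin.≟ x) ≡ true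
≟-refl x = dec-true (x Fin.≟ x) refl

allₛ : ∀ {n} → Sub n
allₛ _ = true

_∪ₛ_ : ∀ {n} → Sub n → Sub n → Sub n
(S ∪ₛ T) i = S i ∨ T i

anyF-elim : ∀ {k} (f : Fin k → Bool) → anyF f ≡ true → ∃ λ i → f i ≡ true
anyF-elim {suc k} f p with ∨-elim {f zero} p
... | inj₁ f₀ = zero , f₀
... | inj₂ fₛ = Product.map suc id (anyF-elim (f ∘ suc) fₛ)

anyF-intro : ∀ {k} (f : Fin k → Bool) i → f i ≡ true → anyF f ≡ true
anyF-intro f zero    p = ∨-introˡ p
anyF-intro f (suc i) p = ∨-introʳ {f zero} (anyF-intro (f ∘ suc) i p)

anyF-false : ∀ k → anyF {k} (λ _ → false) ≡ false
anyF-false zero    = refl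
anyF-false (suc k) = anyF-false k

image-elim : ∀ {k n} (g : Fin k → Fin n) T {j} → image g T j ≡ true → ∃ λ i → T i ≡ true × g i ≡ j
image-elim g T p with anyF-elim _ p
... | i , q = i , ∧-elimˡ q , ≟⇒≡ (∧-elimʳ {T i} q)

image-intro : ∀ {k n} (g : Fin k → Fin n) T {i j} → T i ≡ true → g i ≡ j → image g T j ≡ true
image-intro g T {i} p refl = anyF-intro _ i (∧-intro p (≟-refl (g i)))

image-apply : ∀ {k n} {g : Fin k → Fin n} → Injective _≡_ _≡_ g → ∀ T i → image g T (g i) ≡ T i
image-apply {g = g} inj T i = bool-ext to (λ p → image-intro g T p refl)
  where
  to : image g T (g i) ≡ true → T i ≡ true
  to p with image-elim g T p
  ... | i′ , q , e = subst (λ x → T x ≡ true) (inj e) q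

image-outside : ∀ {k n} {g : Fin k → Fin n} {j} → (∀ i → g i ≢ j) → ∀ T → image g T j ≡ false
image-outside {g = g} j∉g T = Boolₚ.¬-not λ p → let (i , _ , gi≡j) = image-elim g T p in j∉g i gi≡j

image-∅ : ∀ {k n} (g : Fin k → Fin n) → image g ∅ₛ ≗ ∅ₛ
image-∅ {k} g _ = anyF-false k

image-mono : ∀ {k n} (g : Fin k → Fin n) {S T} → T ⊆ₛ S → image g T ⊆ₛ image g S
image-mono g {S} {T} T⊆S j p with image-elim g T p
... | i , q , e = image-intro g S (T⊆S i q) e

image-addₛ : ∀ {k n} (g : Fin k → Fin n) I i → image g (addₛ I i) ≗ addₛ (image g I) (g i)
image-addₛ g I i y = bool-ext to from
  where
  to : image g (addₛ I i) y ≡ true → addₛ (image g I) (g i) y ≡ true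
  to p with image-elim g (addₛ I i) p
  ... | i′ , q , refl with ∨-elim {I i′} q
  ... | inj₁ r = ∨-introˡ (image-intro g I r refl)
  ... | inj₂ r with ≟⇒≡ {x = i} r
  ...   | refl = ∨-introʳ {image g I (g i)} (≟-refl (g i))
  from : addₛ (image g I) (g i) y ≡ true → image g (addₛ I i) y ≡ true
  from p with ∨-elim {image g I y} p
  ... | inj₂ r = image-intro g (addₛ I i) (∨-introʳ {I i} (≟-refl i)) (≟⇒≡ r)
  ... | inj₁ r with image-elim g I r
  ...   | i′ , q , e = image-intro g (addₛ I i) (∨-introˡ q) e

image-∩ₛ : ∀ {k n} (g : Fin k → Fin n) T (A : Sub n) → image g T ∩ₛ A ≗ image g (T ∩ₛ (A ∘ g))
image-∩ₛ g T A j = bool-ext to from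
  where
  to : (image g T ∩ₛ A) j ≡ true → image g (T ∩ₛ (A ∘ g)) j ≡ true
  to p with image-elim g T (∧-elimˡ p)
  ... | i , q , refl = image-intro g _ (∧-intro q (∧-elimʳ {image g T (g i)} p)) refl
  from : image g (T ∩ₛ (A ∘ g)) j ≡ true → (image g T ∩ₛ A) j ≡ true
  from p with image-elim g _ p
  ... | i , q , refl = ∧-intro (image-intro g T (∧-elimˡ q) refl) (∧-elimʳ {T i} q)

image-cong : ∀ {k n} (g : Fin k → Fin n) {T T′} → T ≗ T′ → image g T ≗ image g T′
image-cong g {T} {T′} T≗T′ j = bool-ext
  (λ p → let (i , q , e) = image-elim g T p in image-intro g T′ (trans (sym (T≗T′ i)) q) e)
  (λ p → let (i , q , e) = image-elim g T′ p in image-intro g T (trans (T≗T′ i) q) e)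

∩ₛ-image : ∀ {k n} (g : Fin k → Fin n) (A : Sub n) T → A ∩ₛ image g T ≗ image g ((A ∘ g) ∩ₛ T)
∩ₛ-image g A T j = trans (Boolₚ.∧-comm (A j) (image g T j))
  (trans (image-∩ₛ g T A j) (image-cong g (λ i → Boolₚ.∧-comm (T i) (A (g i))) j))

image-∪ₛ-compl : ∀ {k n} (g : Fin k → Fin n) A → image g A ∪ₛ image g (not ∘ A) ≗ image g allₛ
image-∪ₛ-compl g A j = bool-ext to from
  where
  to : (image g A ∪ₛ image g (not ∘ A)) j ≡ true → image g allₛ j ≡ true
  to p with ∨-elim {image g A j} p
  ... | inj₁ q = image-mono g (λ _ _ → refl) j q
  ... | inj₂ q = image-mono g (λ _ _ → refl) j q
  from : image g allₛ j ≡ true → (image g A ∪ₛ image g (not ∘ A)) j ≡ true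
  from p with image-elim g allₛ p
  ... | i , _ , gi≡j with A i in Ai
  ...   | true  = ∨-introˡ (image-intro g A Ai gi≡j)
  ...   | false = ∨-introʳ {image g A j} (image-intro g (not ∘ A) (cong not Ai) gi≡j)

∪ₛ-∩ₛ-separated : ∀ {n} {X Y C : Sub n} → X ⊆ₛ C → (∀ j → Y j ≡ true → C j ≡ false) → (X ∪ₛ Y) ∩ₛ C ≗ X
∪ₛ-∩ₛ-separated {X = X} {Y} X⊆C Y⊆∁C j with X j in Xj | Y j in Yj
... | true  | _     = X⊆C j Xj
... | false | true  = Y⊆∁C j Yj
... | false | false = refl

∪ₛ-∖ₛ-separated : ∀ {n} {X Y C : Sub n} → X ⊆ₛ C → (∀ j → Y j ≡ true → C j ≡ false) → (X ∪ₛ Y) ∖ₛ C ≗ Y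
∪ₛ-∖ₛ-separated {X = X} {Y} X⊆C Y⊆∁C j with X j in Xj | Y j in Yj
... | true  | true  = ⊥-elim (Boolₚ.not-¬ (X⊆C j Xj) (Y⊆∁C j Yj))
... | true  | false = cong not (X⊆C j Xj)
... | false | true  = cong not (Y⊆∁C j Yj)
... | false | false = refl

addₛ-∘-injective : ∀ {k n} {f : Fin k → Fin n} → Injective _≡_ _≡_ f →
  ∀ S j → addₛ S (f j) ∘ f ≗ addₛ (S ∘ f) j
addₛ-∘-injective {f = f} inj S j i = cong (S (f i) ∨_) (does-⇔ (mk⇔ inj (cong f)) (f j Fin.≟ f i) (j Fin.≟ i))

addₛ-∘-outside : ∀ {k n} {f : Fin k → Fin n} {x} → (∀ i → f i ≢ x) → ∀ S → addₛ S x ∘ f ≗ S ∘ f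
addₛ-∘-outside {f = f} {x} x∉f S i =
  trans (cong (S (f i) ∨_) (dec-false (x Fin.≟ f i) (x∉f i ∘ sym))) (Boolₚ.∨-identityʳ (S (f i)))

addₛ-∩ₛ : ∀ {n} {A : Sub n} {x} → A x ≡ true → ∀ S → addₛ S x ∩ₛ A ≗ addₛ (S ∩ₛ A) x
addₛ-∩ₛ {A = A} {x} Ax S j with x Fin.≟ j
... | yes refl rewrite Ax = trans (Boolₚ.∧-identityʳ _) (trans (Boolₚ.∨-zeroʳ (S x)) (sym (Boolₚ.∨-zeroʳ _)))
... | no  _    = trans (cong (_∧ A j) (Boolₚ.∨-identityʳ (S j))) (sym (Boolₚ.∨-identityʳ _))

addₛ-∖ₛ : ∀ {n} {A : Sub n} {x} → A x ≡ true → ∀ S → addₛ S x ∖ₛ A ≗ S ∖ₛ A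
addₛ-∖ₛ {A = A} {x} Ax S j with x Fin.≟ j
... | yes refl rewrite Ax = trans (Boolₚ.∧-zeroʳ _) (sym (Boolₚ.∧-zeroʳ _))
... | no  _    = cong (_∧ not (A j)) (Boolₚ.∨-identityʳ (S j))

allL-intro : ∀ {A : Set} (p : A → Bool) xs → (∀ a → p a ≡ true) → allL p xs ≡ true
allL-intro p []       _   = refl
allL-intro p (a ∷ as) all = ∧-intro (all a) (allL-intro p as all)

allL-cong : ∀ {A : Set} {p q : A → Bool} → p ≗ q → allL p ≗ allL q
allL-cong p≗q []       = refl
allL-cong p≗q (a ∷ as) = cong₂ _∧_ (p≗q a) (allL-cong p≗q as)


-- Cardinality

card-cong : ∀ {n} {S T : Sub n} → S ≗ T → card S ≡ card T
card-cong {zero}  _   = refl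
card-cong {suc n} S≗T = cong₂ ℕ._+_ (cong (λ b → if b then 1 else 0) (S≗T zero)) (card-cong (S≗T ∘ suc))

card-∅ : ∀ n → card {n} ∅ₛ ≡ 0
card-∅ zero    = refl
card-∅ (suc n) = card-∅ n

card-addₛ : ∀ {n} (S : Sub n) x → S x ≡ false → card (addₛ S x) ≡ suc (card S)
card-addₛ {suc n} S zero    Sx rewrite Sx = cong suc (card-cong (Boolₚ.∨-identityʳ ∘ S ∘ suc))
card-addₛ {suc n} S (suc x) Sx = trans
  (cong₂ ℕ._+_ (cong (λ b → if b then 1 else 0) (Boolₚ.∨-identityʳ (S zero))) (card-addₛ (S ∘ suc) x Sx))
  (ℕₚ.+-suc _ _)

card-splitAt : ∀ m n (S : Sub (m ℕ.+ n)) → card S ≡ card (S ∘ (_↑ˡ n)) ℕ.+ card (S ∘ (m ↑ʳ_))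
card-splitAt zero    n S = refl
card-splitAt (suc m) n S = trans (cong ((if S zero then 1 else 0) ℕ.+_) (card-splitAt m n (S ∘ suc)))
  (sym (ℕₚ.+-assoc (if S zero then 1 else 0) _ _))

card-image : ∀ {k n} {g : Fin k → Fin n} → Injective _≡_ _≡_ g → ∀ T → card (image g T) ≡ card T
card-image {zero} {n} _ T = card-∅ n
card-image {suc k} {g = g} inj T with T zero
... | true  = begin
  card (λ j → does (g zero Fin.≟ j) ∨ image (g ∘ suc) (T ∘ suc) j)
    ≡⟨ card-cong (λ j → Boolₚ.∨-comm (does (g zero Fin.≟ j)) _) ⟩
  card (addₛ (image (g ∘ suc) (T ∘ suc)) (g zero))  ≡⟨ card-addₛ _ (g zero) fresh ⟩
  suc (card (image (g ∘ suc) (T ∘ suc)))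
    ≡⟨ cong suc (card-image (Finₚ.suc-injective ∘ inj) (T ∘ suc)) ⟩
  suc (card (T ∘ suc))                              ∎
  where
  open ≡-Reasoning
  fresh : image (g ∘ suc) (T ∘ suc) (g zero) ≡ false
  fresh = Boolₚ.¬-not λ p → not-preimage (image-elim (g ∘ suc) (T ∘ suc) p)
    where
    not-preimage : ¬ (∃ λ i → T (suc i) ≡ true × g (suc i) ≡ g zero)
    not-preimage (i , _ , e) with inj e
    ... | ()
... | false = card-image (Finₚ.suc-injective ∘ inj) (T ∘ suc)

card-compl : ∀ {k} (A : Sub k) → card A ℕ.+ card (not ∘ A) ≡ k
card-compl {zero}  A = refl
card-compl {suc k} A with A zero
... | true  = cong suc (card-compl (A ∘ suc))
... | false = trans (ℕₚ.+-suc _ _) (cong suc (card-compl (A ∘ suc)))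

+-<-split : ∀ a b c d → a ℕ.+ b < c ℕ.+ d → a < c ⊎ b < d
+-<-split a b c d lt with a ℕ.<? c
... | yes a<c = inj₁ a<c
... | no  a≮c = inj₂ (ℕₚ.+-cancelˡ-< c b d (ℕₚ.≤-<-trans (ℕₚ.+-monoˡ-≤ b (ℕₚ.≮⇒≥ a≮c)) lt))


-- Restriction, direct sum, deletion and contraction

Extensional : ∀ {n} → RawMat n → Set
Extensional M = ∀ {S T} → S ≗ T → M S ≡ M T

indep-cong : ∀ {n} {M : RawMat n} → IsMatroid M → Extensional M
indep-cong im {S} {T} S≗T = bool-ext
  (IsMatroid.hereditary im S T (λ i → trans (S≗T i)))
  (IsMatroid.hereditary im T S (λ i → trans (sym (S≗T i))))

indep-≗∅ : ∀ {n} {M : RawMat n} → IsMatroid M → ∀ {S} → S ≗ ∅ₛ → M S ≡ true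
indep-≗∅ im S≗∅ = trans (indep-cong im S≗∅) (IsMatroid.empty-indep im)

Augmentation : ∀ {n} → RawMat n → Sub n → Sub n → Set
Augmentation {n} M I J = Σ (Fin n) λ j → J j ≡ true × I j ≡ false × M (addₛ I j) ≡ true

IsMatroid-≐ : ∀ {n} {M N : RawMat n} → IsMatroid M → (∀ S → M S ≡ N S) → IsMatroid N
IsMatroid-≐ {N = N} im M≐N = record
  { empty-indep = trans (sym (M≐N ∅ₛ)) (IsMatroid.empty-indep im)
  ; hereditary  = λ S T T⊆S p → trans (sym (M≐N T)) (IsMatroid.hereditary im S T T⊆S (trans (M≐N S) p))
  ; augment     = augment
  }
  where
  augment : ∀ I J → N I ≡ true → N J ≡ true → card I < card J → Augmentation N I J
  augment I J NI NJ lt with IsMatroid.augment im I J (trans (M≐N I) NI) (trans (M≐N J) NJ) lt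
  ... | j , Jj , Ij , MIj = j , Jj , Ij , trans (sym (M≐N _)) MIj

restrict-isMatroid : ∀ {k n} {M : RawMat n} {g : Fin k → Fin n} →
  IsMatroid M → Injective _≡_ _≡_ g → IsMatroid (restrict M g)
restrict-isMatroid {M = M} {g} im inj = record
  { empty-indep = trans (indep-cong im (image-∅ g)) (IsMatroid.empty-indep im)
  ; hereditary  = λ S T T⊆S → IsMatroid.hereditary im _ _ (image-mono g T⊆S)
  ; augment     = augment
  }
  where
  augment : ∀ I J → restrict M g I ≡ true → restrict M g J ≡ true → card I < card J →
            Augmentation (restrict M g) I J
  augment I J MI MJ lt
    with IsMatroid.augment im _ _ MI MJ (subst₂ _<_ (sym (card-image inj I)) (sym (card-image inj J)) lt)
  ... | j , Jj , Ij , MIj with image-elim g J Jj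
  ...   | i , Ji , refl = i , Ji , trans (sym (image-apply inj I i)) Ij ,
                          trans (indep-cong im (image-addₛ g I i)) MIj

↑ˡ≢↑ʳ : ∀ {m n} (i : Fin m) (j : Fin n) → i ↑ˡ n ≢ m ↑ʳ j
↑ˡ≢↑ʳ {m} {n} i j e
  with trans (sym (Finₚ.splitAt-↑ˡ m i n)) (trans (cong (splitAt m) e) (Finₚ.splitAt-↑ʳ m n j))
... | ()

⊕-isMatroid : ∀ {m n} {M : RawMat m} {Q : RawMat n} → IsMatroid M → IsMatroid Q → IsMatroid (M ⊕ Q)
⊕-isMatroid {m} {n} {M} {Q} iM iQ = record
  { empty-indep = ∧-intro (IsMatroid.empty-indep iM) (IsMatroid.empty-indep iQ)
  ; hereditary  = λ S T T⊆S p → ∧-intro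
      (IsMatroid.hereditary iM _ _ (T⊆S ∘ (_↑ˡ n)) (∧-elimˡ p))
      (IsMatroid.hereditary iQ _ _ (T⊆S ∘ (m ↑ʳ_)) (∧-elimʳ {M (S ∘ (_↑ˡ n))} p))
  ; augment     = augment
  }
  where
  ↑ˡ-inj : Injective _≡_ _≡_ (_↑ˡ n)
  ↑ˡ-inj = Finₚ.↑ˡ-injective n _ _
  ↑ʳ-inj : Injective _≡_ _≡_ (m ↑ʳ_)
  ↑ʳ-inj = Finₚ.↑ʳ-injective m _ _
  augment : ∀ I J → (M ⊕ Q) I ≡ true → (M ⊕ Q) J ≡ true → card I < card J → Augmentation (M ⊕ Q) I J
  augment I J MI MJ lt with +-<-split _ _ _ _ (subst₂ _<_ (card-splitAt m n I) (card-splitAt m n J) lt)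
  ... | inj₁ lt-left with IsMatroid.augment iM _ _ (∧-elimˡ MI) (∧-elimˡ MJ) lt-left
  ...   | j , Jj , Ij , MIj = j ↑ˡ n , Jj , Ij , ∧-intro
          (trans (indep-cong iM (addₛ-∘-injective ↑ˡ-inj I j)) MIj)
          (trans (indep-cong iQ (addₛ-∘-outside (λ k → ↑ˡ≢↑ʳ j k ∘ sym) I)) (∧-elimʳ {M (I ∘ (_↑ˡ n))} MI))
  augment I J MI MJ lt | inj₂ lt-right
    with IsMatroid.augment iQ _ _ (∧-elimʳ {M (I ∘ (_↑ˡ n))} MI) (∧-elimʳ {M (J ∘ (_↑ˡ n))} MJ) lt-right
  ...   | j , Jj , Ij , MIj = m ↑ʳ j , Jj , Ij , ∧-intro
          (trans (indep-cong iM (addₛ-∘-outside (λ k → ↑ˡ≢↑ʳ k j) I)) (∧-elimˡ MI))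
          (trans (indep-cong iQ (addₛ-∘-injective ↑ʳ-inj I j)) MIj)

contractFull : ∀ {n} → RawMat n → Fin n → RawMat n
contractFull M x S = M (addₛ S x)

contractFull-extensional : ∀ {n} {M : RawMat n} → IsMatroid M → ∀ x → Extensional (contractFull M x)
contractFull-extensional im x S≗T = indep-cong im (λ j → cong (_∨ does (x Fin.≟ j)) (S≗T j))

contractAlong-isMatroid : ∀ {k n} {M : RawMat n} {x} {g : Fin k → Fin n} →
  IsMatroid M → M (single x) ≡ true → Injective _≡_ _≡_ g → (∀ i → g i ≢ x) →
  IsMatroid (restrict (contractFull M x) g)
contractAlong-isMatroid {M = M} {x} {g} im Mx inj x∉g = record
  { empty-indep = trans (contractFull-extensional im x (image-∅ g)) Mx
  ; hereditary  = λ S T T⊆S → IsMatroid.hereditary im _ _ (addₛ-mono (image-mono g T⊆S))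
  ; augment     = augment
  }
  where
  addₛ-mono : ∀ {S T} → T ⊆ₛ S → addₛ T x ⊆ₛ addₛ S x
  addₛ-mono {S} T⊆S j p with ∨-elim p
  ... | inj₁ Tj = ∨-introˡ (T⊆S j Tj)
  ... | inj₂ x≡j = ∨-introʳ {S j} x≡j
  card-addₛx : ∀ I → card (addₛ (image g I) x) ≡ suc (card I)
  card-addₛx I = trans (card-addₛ _ x (image-outside x∉g I)) (cong suc (card-image inj I))
  augment : ∀ I J → restrict (contractFull M x) g I ≡ true → restrict (contractFull M x) g J ≡ true →
            card I < card J → Augmentation (restrict (contractFull M x) g) I J
  augment I J MI MJ lt
    with IsMatroid.augment im _ _ MI MJ (subst₂ _<_ (sym (card-addₛx I)) (sym (card-addₛx J)) (s≤s lt))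
  ... | j , Jj , Ij , MIj with ∨-elim {image g J j} Jj
  ...   | inj₂ x≡j = ⊥-elim (Boolₚ.not-¬ (∨-introʳ {image g I j} x≡j) Ij)
  ...   | inj₁ gJj with image-elim g J gJj
  ...     | i , Ji , refl = i , Ji , trans (sym (image-apply inj I i)) (Boolₚ.∨-conicalˡ _ _ Ij) ,
                              trans (indep-cong im swap) MIj
    where
    swap : addₛ (image g (addₛ I i)) x ≗ addₛ (addₛ (image g I) x) (g i)
    swap y = trans (cong (_∨ does (x Fin.≟ y)) (image-addₛ g I i y)) (xy∙z≈xz∙y (image g I y) _ _)

punchIn-injective : ∀ {n} (x : Fin (suc n)) → Injective _≡_ _≡_ (punchIn x)
punchIn-injective x = Finₚ.punchIn-injective x _ _

insAt-false : ∀ {n} (x : Fin (suc n)) T → insAt x false T ≗ image (punchIn x) T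
insAt-false x T j with x Fin.≟ j
... | yes refl = sym (image-outside (Finₚ.punchInᵢ≢i x) T)
... | no  x≢j  = sym (trans (cong (image (punchIn x) T) (sym (Finₚ.punchIn-punchOut x≢j)))
                            (image-apply (punchIn-injective x) T (punchOut x≢j)))

insAt-true : ∀ {n} (x : Fin (suc n)) T → insAt x true T ≗ addₛ (insAt x false T) x
insAt-true x T j with x Fin.≟ j
... | yes _ = refl
... | no  _ = sym (Boolₚ.∨-identityʳ _)

isLoop-false : ∀ {n} {M : RawMat n} {x} → isLoop M x ≡ false → M (single x) ≡ true
isLoop-false = Boolₚ.not-injective

delete≐restrict : ∀ {n} {M : RawMat (suc n)} → IsMatroid M → ∀ x S → restrict M (punchIn x) S ≡ delete M x S
delete≐restrict im x S = indep-cong im (λ j → sym (insAt-false x S j))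

contract≐restrict : ∀ {n} {M : RawMat (suc n)} → IsMatroid M → ∀ {x} → isLoop M x ≡ false →
  ∀ S → restrict (contractFull M x) (punchIn x) S ≡ contract M x S
contract≐restrict im {x} nonLoop S rewrite nonLoop =
  trans (contractFull-extensional im x (sym ∘ insAt-false x S)) (indep-cong im (sym ∘ insAt-true x S))

delete-isMatroid : ∀ {n} {M : RawMat (suc n)} → IsMatroid M → ∀ x → IsMatroid (delete M x)
delete-isMatroid im x = IsMatroid-≐ (restrict-isMatroid im (punchIn-injective x)) (delete≐restrict im x)

contract-isMatroid : ∀ {n} {M : RawMat (suc n)} → IsMatroid M → ∀ {x} → isLoop M x ≡ false →
  IsMatroid (contract M x)
contract-isMatroid {M = M} im {x} nonLoop = IsMatroid-≐
  (contractAlong-isMatroid im (isLoop-false {M = M} {x} nonLoop) (punchIn-injective x) (Finₚ.punchInᵢ≢i x))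
  (contract≐restrict im {x} nonLoop)


-- Separators

IsSeparator-≐ : ∀ {n} {N N′ : RawMat n} {A} → (∀ S → N S ≡ N′ S) → IsSeparator N A → IsSeparator N′ A
IsSeparator-≐ N≐N′ sep S = trans (sym (N≐N′ S)) (trans (sep S) (cong₂ _∧_ (N≐N′ _) (N≐N′ _)))

IsSeparator-cong : ∀ {n} {N : RawMat n} {A B} → Extensional N → A ≗ B → IsSeparator N A → IsSeparator N B
IsSeparator-cong ext A≗B sep S = trans (sep S) (cong₂ _∧_
  (ext (λ i → cong (S i ∧_) (A≗B i))) (ext (λ i → cong (λ b → S i ∧ not b) (A≗B i))))

IsSeparator-compl : ∀ {n} {N : RawMat n} {A} → Extensional N → IsSeparator N A → IsSeparator N (not ∘ A)
IsSeparator-compl {N = N} {A} ext sep S = trans (sep S) (trans (Boolₚ.∧-comm (N (S ∩ₛ A)) _)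
  (cong (N (S ∖ₛ A) ∧_) (ext (λ i → cong (S i ∧_) (sym (Boolₚ.not-involutive (A i)))))))

IsSeparator-restrict : ∀ {k n} {M : RawMat n} {A} (g : Fin k → Fin n) → Extensional M →
  IsSeparator M A → IsSeparator (restrict M g) (A ∘ g)
IsSeparator-restrict {A = A} g ext sep S = trans (sep (image g S)) (cong₂ _∧_
  (ext (image-∩ₛ g S A)) (ext (image-∩ₛ g S (not ∘ A))))

IsSeparator-contractFull : ∀ {n} {M : RawMat n} {A x} → IsMatroid M → M (single x) ≡ true → A x ≡ true →
  IsSeparator M A → IsSeparator (contractFull M x) A
IsSeparator-contractFull {M = M} {A} {x} im Mx Ax sep S = begin
  M (addₛ S x)                                ≡⟨ sep (addₛ S x) ⟩
  M (addₛ S x ∩ₛ A) ∧ M (addₛ S x ∖ₛ A)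
    ≡⟨ cong₂ _∧_ (indep-cong im (addₛ-∩ₛ Ax S)) (indep-cong im (addₛ-∖ₛ Ax S)) ⟩
  M (addₛ (S ∩ₛ A) x) ∧ M (S ∖ₛ A)            ≡⟨ cong (M (addₛ (S ∩ₛ A) x) ∧_) x-free ⟨
  M (addₛ (S ∩ₛ A) x) ∧ M (addₛ (S ∖ₛ A) x)   ∎
  where
  open ≡-Reasoning
  x-free : M (addₛ (S ∖ₛ A) x) ≡ M (S ∖ₛ A)
  x-free = begin
    M (addₛ (S ∖ₛ A) x)                                 ≡⟨ sep _ ⟩
    M (addₛ (S ∖ₛ A) x ∩ₛ A) ∧ M (addₛ (S ∖ₛ A) x ∖ₛ A)
      ≡⟨ cong₂ _∧_ (indep-cong im only-x) (indep-cong im (addₛ-∖ₛ Ax (S ∖ₛ A))) ⟩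
    M (single x) ∧ M ((S ∖ₛ A) ∖ₛ A)                    ≡⟨ cong₂ _∧_ Mx (indep-cong im twice) ⟩
    M (S ∖ₛ A)                                          ∎
    where
    only-x : addₛ (S ∖ₛ A) x ∩ₛ A ≗ single x
    only-x j = trans (addₛ-∩ₛ {A = A} Ax (S ∖ₛ A) j)
      (cong (_∨ does (x Fin.≟ j)) (trans (Boolₚ.∧-assoc (S j) _ _)
        (trans (cong (S j ∧_) (Boolₚ.∧-inverseˡ (A j))) (Boolₚ.∧-zeroʳ (S j)))))
    twice : (S ∖ₛ A) ∖ₛ A ≗ S ∖ₛ A
    twice j = trans (Boolₚ.∧-assoc (S j) _ _) (cong (S j ∧_) (Boolₚ.∧-idem (not (A j))))

IsSeparator-lift : ∀ {k n} {M : RawMat n} {g : Fin k → Fin n} {A} → IsMatroid M → Injective _≡_ _≡_ g →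
  IsSeparator M (image g allₛ) → IsSeparator (restrict M g) A → IsSeparator M (image g A)
IsSeparator-lift {M = M} {g} {A} im inj sepG sepA S = begin
  M S
    ≡⟨ sepG S ⟩
  M (S ∩ₛ G) ∧ M (S ∖ₛ G)
    ≡⟨ cong (_∧ M (S ∖ₛ G)) (trans (indep-cong im in-G) (sepA (S ∘ g))) ⟩
  (M (image g ((S ∘ g) ∩ₛ A)) ∧ M (image g ((S ∘ g) ∖ₛ A))) ∧ M (S ∖ₛ G)
    ≡⟨ cong (_∧ M (S ∖ₛ G)) (cong₂ _∧_ (indep-cong im (∩ₛ-image g S A)) (indep-cong im rest-in-G)) ⟨
  (M (S ∩ₛ GA) ∧ M ((S ∖ₛ GA) ∩ₛ G)) ∧ M (S ∖ₛ G)
    ≡⟨ Boolₚ.∧-assoc (M (S ∩ₛ GA)) _ _ ⟩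
  M (S ∩ₛ GA) ∧ (M ((S ∖ₛ GA) ∩ₛ G) ∧ M (S ∖ₛ G))
    ≡⟨ cong (λ b → M (S ∩ₛ GA) ∧ (M ((S ∖ₛ GA) ∩ₛ G) ∧ b)) (indep-cong im rest-outside-G) ⟨
  M (S ∩ₛ GA) ∧ (M ((S ∖ₛ GA) ∩ₛ G) ∧ M ((S ∖ₛ GA) ∖ₛ G))
    ≡⟨ cong (M (S ∩ₛ GA) ∧_) (sepG (S ∖ₛ GA)) ⟨
  M (S ∩ₛ GA) ∧ M (S ∖ₛ GA)
    ∎
  where
  open ≡-Reasoning
  G GA : Sub _
  G  = image g allₛ
  GA = image g A
  in-G : S ∩ₛ G ≗ image g (S ∘ g)
  in-G j = trans (Boolₚ.∧-comm (S j) (G j)) (image-∩ₛ g allₛ S j)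
  rest-in-G : (S ∖ₛ GA) ∩ₛ G ≗ image g ((S ∘ g) ∖ₛ A)
  rest-in-G j = trans (∩ₛ-image g (S ∖ₛ GA) allₛ j) (image-cong g
    (λ i → trans (Boolₚ.∧-identityʳ _) (cong (λ b → S (g i) ∧ not b) (image-apply inj A i))) j)
  rest-outside-G : (S ∖ₛ GA) ∖ₛ G ≗ S ∖ₛ G
  rest-outside-G j = bool-ext to from
    where
    to : ((S ∖ₛ GA) ∖ₛ G) j ≡ true → (S ∖ₛ G) j ≡ true
    to p = ∧-intro (∧-elimˡ (∧-elimˡ p)) (∧-elimʳ {(S ∖ₛ GA) j} p)
    from : (S ∖ₛ G) j ≡ true → ((S ∖ₛ GA) ∖ₛ G) j ≡ true
    from p = ∧-intro (∧-intro (∧-elimˡ p) (cong not GA-false)) (∧-elimʳ {S j} p)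
      where
      GA-false : GA j ≡ false
      GA-false = Boolₚ.¬-not λ GAj →
        Boolₚ.not-¬ (image-mono g {allₛ} {A} (λ _ _ → refl) j GAj) (Boolₚ.not-injective (∧-elimʳ {S j} p))

⊕-disconnected : ∀ {m n} {M : RawMat (suc m)} {Q : RawMat (suc n)} →
  IsMatroid M → IsMatroid Q → Disconnected (M ⊕ Q)
⊕-disconnected {m} {n} {M} {Q} iM iQ = L , (zero , in-L zero) , (suc m ↑ʳ zero , out-L zero) , separates
  where
  inl : Fin (suc m) → Fin (suc m ℕ.+ suc n)
  inl = _↑ˡ suc n
  inr : Fin (suc n) → Fin (suc m ℕ.+ suc n)
  inr = suc m ↑ʳ_
  L : Sub (suc m ℕ.+ suc n)
  L = image inl allₛ
  in-L : ∀ i → L (inl i) ≡ true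
  in-L = image-apply {g = inl} (Finₚ.↑ˡ-injective (suc n) _ _) allₛ
  out-L : ∀ j → L (inr j) ≡ false
  out-L j = image-outside {g = inl} (λ i → ↑ˡ≢↑ʳ i j) allₛ
  separates : IsSeparator (M ⊕ Q) L
  separates S = sym (begin
    (M ((S ∩ₛ L) ∘ inl) ∧ Q ((S ∩ₛ L) ∘ inr)) ∧ (M ((S ∖ₛ L) ∘ inl) ∧ Q ((S ∖ₛ L) ∘ inr))
      ≡⟨ cong₂ _∧_ (cong₂ _∧_ (indep-cong iM ∩L-inl) (indep-≗∅ iQ ∩L-inr))
                   (cong₂ _∧_ (indep-≗∅ iM ∖L-inl) (indep-cong iQ ∖L-inr)) ⟩
    (M (S ∘ inl) ∧ true) ∧ Q (S ∘ inr)
      ≡⟨ cong (_∧ Q (S ∘ inr)) (Boolₚ.∧-identityʳ _) ⟩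
    M (S ∘ inl) ∧ Q (S ∘ inr)
      ∎)
    where
    open ≡-Reasoning
    ∩L-inl : (S ∩ₛ L) ∘ inl ≗ S ∘ inl
    ∩L-inl i = trans (cong (S (inl i) ∧_) (in-L i)) (Boolₚ.∧-identityʳ _)
    ∩L-inr : (S ∩ₛ L) ∘ inr ≗ ∅ₛ
    ∩L-inr j = trans (cong (S (inr j) ∧_) (out-L j)) (Boolₚ.∧-zeroʳ _)
    ∖L-inl : (S ∖ₛ L) ∘ inl ≗ ∅ₛ
    ∖L-inl i = trans (cong (λ b → S (inl i) ∧ not b) (in-L i)) (Boolₚ.∧-zeroʳ _)
    ∖L-inr : (S ∖ₛ L) ∘ inr ≗ S ∘ inr
    ∖L-inr j = trans (cong (λ b → S (inr j) ∧ not b) (out-L j)) (Boolₚ.∧-identityʳ _)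

singleton-separator⇒isColoop : ∀ {n} {M : RawMat n} {x} → IsMatroid M → M (single x) ≡ true →
  IsSeparator M (single x) → isColoop M x ≡ true
singleton-separator⇒isColoop {n} {M} {x} im Mx sep = allL-intro _ (allSubsets n) extendable
  where
  extendable : ∀ S → not (M S) ∨ M (addₛ S x) ≡ true
  extendable S with M S in MS
  ... | false = refl
  ... | true  = trans (sep (addₛ S x)) (∧-intro (trans (indep-cong im x-part) Mx)
                                                (IsMatroid.hereditary im S _ rest-part MS))
    where
    x-part : addₛ S x ∩ₛ single x ≗ single x
    x-part i with x Fin.≟ i
    ... | yes _ = trans (Boolₚ.∧-identityʳ _) (Boolₚ.∨-zeroʳ (S i))
    ... | no  _ = Boolₚ.∧-zeroʳ _
    rest-part : (addₛ S x ∖ₛ single x) ⊆ₛ S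
    rest-part i p with x Fin.≟ i
    ... | yes _ with ∧-elimʳ {S i ∨ true} p
    ...   | ()
    rest-part i p | no _ = trans (sym (Boolₚ.∨-identityʳ (S i))) (∧-elimˡ p)

isColoop-Fin1 : ∀ {M : RawMat 1} {x} → IsMatroid M → M (single x) ≡ true → isColoop M x ≡ true
isColoop-Fin1 {M} {zero} im Mx = singleton-separator⇒isColoop {x = zero} im Mx separates
  where
  separates : IsSeparator M (single zero)
  separates S = sym (trans (cong₂ _∧_ (indep-cong im whole) (indep-≗∅ im empty)) (Boolₚ.∧-identityʳ (M S)))
    where
    whole : S ∩ₛ single zero ≗ S
    whole zero = Boolₚ.∧-identityʳ (S zero)
    empty : S ∖ₛ single zero ≗ ∅ₛ
    empty zero = Boolₚ.∧-zeroʳ (S zero)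

separator∋nonColoop⇒∃other : ∀ {n} {M : RawMat n} {A x} → IsMatroid M → M (single x) ≡ true →
  isColoop M x ≡ false → IsSeparator M A → A x ≡ true → ∃ λ j → j ≢ x × A j ≡ true
separator∋nonColoop⇒∃other {M = M} {A} {x} im Mx nonColoop sep Ax
  with Finₚ.any? (λ j → ¬? (j Fin.≟ x) ×-dec (A j Bool.≟ true))
... | yes other = other
... | no ¬other = ⊥-elim (Boolₚ.not-¬ coloop nonColoop)
  where
  A≗x : A ≗ single x
  A≗x j with x Fin.≟ j
  ... | yes refl = Ax
  ... | no  x≢j  = Boolₚ.¬-not λ Aj → ¬other (j , x≢j ∘ sym , Aj)
  coloop : isColoop M x ≡ true
  coloop = singleton-separator⇒isColoop {x = x} im Mx (IsSeparator-cong (indep-cong im) A≗x sep)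

disconnected⇒separator∋nonColoop : ∀ {n} {M : RawMat n} {x} → IsMatroid M → M (single x) ≡ true →
  isColoop M x ≡ false → Disconnected M →
  Σ (Sub n) λ A → IsSeparator M A × A x ≡ true × (∃ λ j → j ≢ x × A j ≡ true) × (∃ λ j → A j ≡ false)
disconnected⇒separator∋nonColoop {M = M} {x} im Mx nonColoop (A , (i , Ai) , (i′ , Ai′) , sep) with A x in Ax
... | true  = A , sep , Ax , separator∋nonColoop⇒∃other im Mx nonColoop sep Ax , (i′ , Ai′)
... | false = not ∘ A , sep′ , cong not Ax , separator∋nonColoop⇒∃other im Mx nonColoop sep′ (cong not Ax) ,
              (i , cong not Ai)
  where
  sep′ : IsSeparator M (not ∘ A)
  sep′ = IsSeparator-compl (indep-cong im) sep

punchIn-disconnected : ∀ {n} {N : RawMat n} {x : Fin (suc n)} (A : Sub (suc n)) → A x ≡ true →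
  (∃ λ j → j ≢ x × A j ≡ true) → (∃ λ j → A j ≡ false) → IsSeparator N (A ∘ punchIn x) → Disconnected N
punchIn-disconnected {x = x} A Ax (j , j≢x , Aj) (j′ , Aj′) sep =
  A ∘ punchIn x ,
  (punchOut (j≢x ∘ sym) , trans (cong A (Finₚ.punchIn-punchOut _)) Aj) ,
  (punchOut x≢j′ , trans (cong A (Finₚ.punchIn-punchOut _)) Aj′) ,
  sep
  where
  x≢j′ : x ≢ j′
  x≢j′ refl = Boolₚ.not-¬ Ax Aj′

delete-disconnected : ∀ {n} {M : RawMat (suc n)} {x} → IsMatroid M → isLoop M x ≡ false →
  isColoop M x ≡ false → Disconnected M → Disconnected (delete M x)
delete-disconnected {M = M} {x} im nonLoop nonColoop dM
  with disconnected⇒separator∋nonColoop im (isLoop-false {M = M} {x} nonLoop) nonColoop dM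
... | A , sep , Ax , inside , outside = punchIn-disconnected A Ax inside outside
  (IsSeparator-≐ (delete≐restrict im x) (IsSeparator-restrict (punchIn x) (indep-cong im) sep))

contract-disconnected : ∀ {n} {M : RawMat (suc n)} {x} → IsMatroid M → isLoop M x ≡ false →
  isColoop M x ≡ false → Disconnected M → Disconnected (contract M x)
contract-disconnected {M = M} {x} im nonLoop nonColoop dM
  with disconnected⇒separator∋nonColoop im (isLoop-false {M = M} {x} nonLoop) nonColoop dM
... | A , sep , Ax , inside , outside = punchIn-disconnected A Ax inside outside
  (IsSeparator-≐ (contract≐restrict im {x} nonLoop)
    (IsSeparator-restrict (punchIn x) (contractFull-extensional im x)
      (IsSeparator-contractFull im (isLoop-false {M = M} {x} nonLoop) Ax sep)))

anySub? : ∀ {n} {Q : Sub n → Set} → (∀ {S T} → S ≗ T → Q S → Q T) → (∀ S → Dec (Q S)) → Dec (∃ Q)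
anySub? resp Q? = map′ (Product.map lookup id)
  (λ (S , QS) → tabulate S , resp (sym ∘ lookup∘tabulate S) QS) (anySubset? (Q? ∘ lookup))

allSub? : ∀ {n} {Q : Sub n → Set} → (∀ {S T} → S ≗ T → Q S → Q T) → (∀ S → Dec (Q S)) → Dec (∀ S → Q S)
allSub? resp Q? with anySub? (λ S≗T ¬QS QT → ¬QS (resp (sym ∘ S≗T) QT)) (¬? ∘ Q?)
... | yes (S , ¬QS) = no λ all → ¬QS (all S)
... | no  ¬counter  = yes λ S → decidable-stable (Q? S) (λ ¬QS → ¬counter (S , ¬QS))

IsSeparator? : ∀ {n} {N : RawMat n} → Extensional N → ∀ A → Dec (IsSeparator N A)
IsSeparator? {N = N} ext A = allSub? respects (λ S → N S Bool.≟ (N (S ∩ₛ A) ∧ N (S ∖ₛ A)))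
  where
  respects : ∀ {S T} → S ≗ T → N S ≡ (N (S ∩ₛ A) ∧ N (S ∖ₛ A)) → N T ≡ (N (T ∩ₛ A) ∧ N (T ∖ₛ A))
  respects S≗T e = trans (ext (sym ∘ S≗T)) (trans e (cong₂ _∧_
    (ext (λ i → cong (_∧ A i) (S≗T i))) (ext (λ i → cong (λ b → b ∧ not (A i)) (S≗T i)))))

Disconnected? : ∀ {n} {N : RawMat n} → Extensional N → Dec (Disconnected N)
Disconnected? {n} {N} ext = anySub? respects λ A →
  Finₚ.any? (λ i → A i Bool.≟ true) ×-dec Finₚ.any? (λ i → A i Bool.≟ false) ×-dec IsSeparator? ext A
  where
  Splits : Sub n → Set
  Splits A = (∃ λ i → A i ≡ true) × (∃ λ i → A i ≡ false) × IsSeparator N A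
  respects : ∀ {A B} → A ≗ B → Splits A → Splits B
  respects A≗B ((i , Ai) , (i′ , Ai′) , sep) =
    (i , trans (sym (A≗B i)) Ai) , (i′ , trans (sym (A≗B i′)) Ai′) , IsSeparator-cong ext A≗B sep


-- Enumerations of subsets

record Enumerates {k n} (h : Fin k → Fin n) (C : Sub n) : Set where
  field
    injective : Injective _≡_ _≡_ h
    into      : ∀ i → C (h i) ≡ true
    onto      : ∀ j → C j ≡ true → ∃ λ i → h i ≡ j

Enumerates-cong : ∀ {k n} {h : Fin k → Fin n} {C D} → C ≗ D → Enumerates h C → Enumerates h D
Enumerates-cong C≗D e = record
  { injective = injective
  ; into      = λ i → trans (sym (C≗D _)) (into i)
  ; onto      = λ j Dj → onto j (trans (C≗D j) Dj)
  }
  where open Enumerates e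

Enumerates⇒image≗ : ∀ {k n} {h : Fin k → Fin n} {C} → Enumerates h C → image h allₛ ≗ C
Enumerates⇒image≗ {h = h} {C} e j = bool-ext
  (λ p → let (i , _ , hi≡j) = image-elim h allₛ p in subst (λ y → C y ≡ true) hi≡j (into i))
  (λ Cj → let (i , hi≡j) = onto j Cj in image-intro h allₛ refl hi≡j)
  where open Enumerates e

Enumerates-allₛ⇒≡ : ∀ {K n} {h : Fin K → Fin n} → Enumerates h allₛ → K ≡ n
Enumerates-allₛ⇒≡ {h = h} E = Finₚ.cantor-schröder-bernstein injective h⁻¹-injective
  where
  open Enumerates E
  h⁻¹-injective : Injective _≡_ _≡_ (λ j → proj₁ (onto j refl))
  h⁻¹-injective {j} {j′} e = trans (sym (proj₂ (onto j refl))) (trans (cong h e) (proj₂ (onto j′ refl)))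

consEnum : ∀ {m k} (b : Bool) → (Fin m → Fin k) → Fin ((if b then 1 else 0) ℕ.+ m) → Fin (suc k)
consEnum true  e zero    = zero
consEnum true  e (suc i) = suc (e i)
consEnum false e i       = suc (e i)

consEnum-Enumerates : ∀ {m k} {A : Sub (suc k)} {e : Fin m → Fin k} →
  Enumerates e (A ∘ suc) → Enumerates (consEnum (A zero) e) A
consEnum-Enumerates {A = A} {e} eE with A zero in A₀
... | true  = record { injective = injective ; into = into ; onto = onto }
  where
  open Enumerates eE renaming (injective to e-inj; into to e-into; onto to e-onto)
  injective : Injective _≡_ _≡_ (consEnum true e)
  injective {zero}  {zero}  _ = refl
  injective {suc i} {suc j} p = cong suc (e-inj (Finₚ.suc-injective p))
  into : ∀ i → A (consEnum true e i) ≡ true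
  into zero    = A₀
  into (suc i) = e-into i
  onto : ∀ j → A j ≡ true → ∃ λ i → consEnum true e i ≡ j
  onto zero    _  = zero , refl
  onto (suc j) Aj = Product.map suc (cong suc) (e-onto j Aj)
... | false = record { injective = e-inj ∘ Finₚ.suc-injective ; into = e-into ; onto = onto }
  where
  open Enumerates eE renaming (injective to e-inj; into to e-into; onto to e-onto)
  onto : ∀ j → A j ≡ true → ∃ λ i → consEnum false e i ≡ j
  onto zero    A₀′ = ⊥-elim (Boolₚ.not-¬ A₀′ A₀)
  onto (suc j) Aj  = Product.map id (cong suc) (e-onto j Aj)

enum : ∀ {k} (A : Sub k) → Fin (card A) → Fin k
enum {zero}  A ()
enum {suc k} A = consEnum (A zero) (enum (A ∘ suc))

enum-Enumerates : ∀ {k} (A : Sub k) → Enumerates (enum A) A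
enum-Enumerates {zero}  A = record { injective = λ {} ; into = λ () ; onto = λ () }
enum-Enumerates {suc k} A = consEnum-Enumerates (enum-Enumerates (A ∘ suc))

card-pos : ∀ {k} (A : Sub k) {i} → A i ≡ true → 0 < card A
card-pos A Ai = ℕₚ.≤-<-trans z≤n (Finₚ.toℕ<n (proj₁ (Enumerates.onto (enum-Enumerates A) _ Ai)))

splitAt-view : ∀ a b (x : Fin (a ℕ.+ b)) → (∃ λ i → i ↑ˡ b ≡ x) ⊎ (∃ λ j → a ↑ʳ j ≡ x)
splitAt-view a b x with splitAt a x in eq
... | inj₁ i = inj₁ (i , Finₚ.splitAt⁻¹-↑ˡ eq)
... | inj₂ j = inj₂ (j , Finₚ.splitAt⁻¹-↑ʳ eq)

image-++ᶠ : ∀ {a b n} (h₁ : Fin a → Fin n) (h₂ : Fin b → Fin n) S →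
  image (h₁ ++ᶠ h₂) S ≗ image h₁ (S ∘ (_↑ˡ b)) ∪ₛ image h₂ (S ∘ (a ↑ʳ_))
image-++ᶠ {a} {b} h₁ h₂ S j = bool-ext to from
  where
  to : image (h₁ ++ᶠ h₂) S j ≡ true → (image h₁ (S ∘ (_↑ˡ b)) ∪ₛ image h₂ (S ∘ (a ↑ʳ_))) j ≡ true
  to p with image-elim (h₁ ++ᶠ h₂) S p
  ... | x , Sx , refl with splitAt-view a b x
  ...   | inj₁ (i , refl) = ∨-introˡ (image-intro h₁ _ Sx (sym (Vecᶠₚ.lookup-++ˡ h₁ h₂ i)))
  ...   | inj₂ (i , refl) =
    ∨-introʳ {image h₁ (S ∘ (_↑ˡ b)) _} (image-intro h₂ _ Sx (sym (Vecᶠₚ.lookup-++ʳ h₁ h₂ i)))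
  from : (image h₁ (S ∘ (_↑ˡ b)) ∪ₛ image h₂ (S ∘ (a ↑ʳ_))) j ≡ true → image (h₁ ++ᶠ h₂) S j ≡ true
  from p with ∨-elim {image h₁ (S ∘ (_↑ˡ b)) j} p
  ... | inj₁ q = let (i , Si , e) = image-elim h₁ _ q in
    image-intro (h₁ ++ᶠ h₂) S Si (trans (Vecᶠₚ.lookup-++ˡ h₁ h₂ i) e)
  ... | inj₂ q = let (i , Si , e) = image-elim h₂ _ q in
    image-intro (h₁ ++ᶠ h₂) S Si (trans (Vecᶠₚ.lookup-++ʳ h₁ h₂ i) e)

++ᶠ-Enumerates : ∀ {a b n} {h₁ : Fin a → Fin n} {h₂ : Fin b → Fin n} {C₁ C₂} →
  Enumerates h₁ C₁ → Enumerates h₂ C₂ → (∀ j → C₂ j ≡ true → C₁ j ≡ false) → Enumerates (h₁ ++ᶠ h₂) (C₁ ∪ₛ C₂)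
++ᶠ-Enumerates {a} {b} {n} {h₁} {h₂} {C₁} {C₂} e₁ e₂ disjoint = record
  { injective = injective ; into = into ; onto = onto }
  where
  module E₁ = Enumerates e₁
  module E₂ = Enumerates e₂
  h : Fin (a ℕ.+ b) → Fin n
  h = h₁ ++ᶠ h₂
  apart : ∀ i j → h₁ i ≢ h₂ j
  apart i j e = Boolₚ.not-¬ (E₁.into i) (trans (cong C₁ e) (disjoint _ (E₂.into j)))
  injective : Injective _≡_ _≡_ h
  injective {x} {y} e with splitAt-view a b x | splitAt-view a b y
  ... | inj₁ (i , refl) | inj₁ (i′ , refl) =
    cong (_↑ˡ b) (E₁.injective (trans (sym (Vecᶠₚ.lookup-++ˡ h₁ h₂ i)) (trans e (Vecᶠₚ.lookup-++ˡ h₁ h₂ i′))))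
  ... | inj₂ (j , refl) | inj₂ (j′ , refl) =
    cong (a ↑ʳ_) (E₂.injective (trans (sym (Vecᶠₚ.lookup-++ʳ h₁ h₂ j)) (trans e (Vecᶠₚ.lookup-++ʳ h₁ h₂ j′))))
  ... | inj₁ (i , refl) | inj₂ (j , refl) =
    ⊥-elim (apart i j (trans (sym (Vecᶠₚ.lookup-++ˡ h₁ h₂ i)) (trans e (Vecᶠₚ.lookup-++ʳ h₁ h₂ j))))
  ... | inj₂ (j , refl) | inj₁ (i , refl) =
    ⊥-elim (apart i j (trans (sym (Vecᶠₚ.lookup-++ˡ h₁ h₂ i)) (trans (sym e) (Vecᶠₚ.lookup-++ʳ h₁ h₂ j))))
  into : ∀ x → (C₁ ∪ₛ C₂) (h x) ≡ true
  into x with splitAt-view a b x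
  ... | inj₁ (i , refl) rewrite Vecᶠₚ.lookup-++ˡ h₁ h₂ i = ∨-introˡ (E₁.into i)
  ... | inj₂ (j , refl) rewrite Vecᶠₚ.lookup-++ʳ h₁ h₂ j = ∨-introʳ {C₁ (h₂ j)} (E₂.into j)
  onto : ∀ y → (C₁ ∪ₛ C₂) y ≡ true → ∃ λ x → h x ≡ y
  onto y p with ∨-elim {C₁ y} p
  ... | inj₁ q = let (i , e) = E₁.onto y q in i ↑ˡ b , trans (Vecᶠₚ.lookup-++ˡ h₁ h₂ i) e
  ... | inj₂ q = let (j , e) = E₂.onto y q in a ↑ʳ j , trans (Vecᶠₚ.lookup-++ʳ h₁ h₂ j) e

restrict-++ᶠ : ∀ {a b n} {M : RawMat n} {C} {h₁ : Fin a → Fin n} {h₂ : Fin b → Fin n} →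
  Extensional M → IsSeparator M C → (∀ i → C (h₁ i) ≡ true) → (∀ j → C (h₂ j) ≡ false) →
  ∀ S → restrict M (h₁ ++ᶠ h₂) S ≡ (restrict M h₁ ⊕ restrict M h₂) S
restrict-++ᶠ {a} {b} {C = C} {h₁} {h₂} ext sep into₁ into₂ S = trans (sep _) (cong₂ _∧_
  (ext (λ j → trans (cong (_∧ C j) (image-++ᶠ h₁ h₂ S j)) (∪ₛ-∩ₛ-separated in-C out-C j)))
  (ext (λ j → trans (cong (λ b → b ∧ not (C j)) (image-++ᶠ h₁ h₂ S j)) (∪ₛ-∖ₛ-separated in-C out-C j))))
  where
  in-C : image h₁ (S ∘ (_↑ˡ b)) ⊆ₛ C
  in-C j p = let (i , _ , e) = image-elim h₁ _ p in subst (λ y → C y ≡ true) e (into₁ i)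
  out-C : ∀ j → image h₂ (S ∘ (a ↑ʳ_)) j ≡ true → C j ≡ false
  out-C j p = let (i , _ , e) = image-elim h₂ _ p in subst (λ y → C y ≡ false) e (into₂ i)


-- Formal linear combinations

lin : List (ℚ × FC) → FC
lin = concatMap (λ p → scale (proj₁ p) (proj₂ p))

coeff-++ : ∀ s v w → coeff s (v ++ w) ≡ coeff s v ℚ.+ coeff s w
coeff-++ s []      w = sym (ℚₚ.+-identityˡ _)
coeff-++ s (p ∷ v) w = trans (cong (c ℚ.+_) (coeff-++ s v w)) (sym (ℚₚ.+-assoc c (coeff s v) (coeff s w)))
  where
  c : ℚ
  c = if symEq s (proj₂ p) then proj₁ p else 0ℚ

coeff-scale : ∀ s q v → coeff s (scale q v) ≡ q ℚ.* coeff s v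
coeff-scale s q []            = sym (ℚₚ.*-zeroʳ q)
coeff-scale s q ((c , u) ∷ v) =
  trans (cong₂ ℚ._+_ (head (symEq s u)) (coeff-scale s q v)) (sym (ℚₚ.*-distribˡ-+ q _ _))
  where
  head : ∀ b → (if b then q ℚ.* c else 0ℚ) ≡ q ℚ.* (if b then c else 0ℚ)
  head true  = refl
  head false = sym (ℚₚ.*-zeroʳ q)

coeff-lin-scale : ∀ s q xs → coeff s (lin (map (Product.map₁ (q ℚ.*_)) xs)) ≡ q ℚ.* coeff s (lin xs)
coeff-lin-scale s q []            = sym (ℚₚ.*-zeroʳ q)
coeff-lin-scale s q ((c , u) ∷ xs) = begin
  coeff s (scale (q ℚ.* c) u ++ lin (map (Product.map₁ (q ℚ.*_)) xs))
    ≡⟨ coeff-++ s (scale (q ℚ.* c) u) _ ⟩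
  coeff s (scale (q ℚ.* c) u) ℚ.+ coeff s (lin (map (Product.map₁ (q ℚ.*_)) xs))
    ≡⟨ cong₂ ℚ._+_ (coeff-scale s (q ℚ.* c) u) (coeff-lin-scale s q xs) ⟩
  q ℚ.* c ℚ.* coeff s u ℚ.+ q ℚ.* coeff s (lin xs)
    ≡⟨ distribute q c (coeff s u) (coeff s (lin xs)) ⟩
  q ℚ.* (c ℚ.* coeff s u ℚ.+ coeff s (lin xs))
    ≡⟨ cong (q ℚ.*_) (trans (coeff-++ s (scale c u) (lin xs))
                            (cong (ℚ._+ coeff s (lin xs)) (coeff-scale s c u))) ⟨
  q ℚ.* coeff s (scale c u ++ lin xs) ∎
  where
  open ≡-Reasoning
  open +-*-Solver
  distribute : ∀ q c u b → q ℚ.* c ℚ.* u ℚ.+ q ℚ.* b ≡ q ℚ.* (c ℚ.* u ℚ.+ b)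
  distribute = solve 4 (λ q c u b → q :* c :* u :+ q :* b := q :* (c :* u :+ b)) refl

coeff-−F : ∀ s v w → coeff s (v −F w) ≡ coeff s v ℚ.+ ℚ.- 1ℚ ℚ.* coeff s w
coeff-−F s v w = trans (coeff-++ s v _) (cong (coeff s v ℚ.+_) (coeff-scale s (ℚ.- 1ℚ) w))

−F-cancelˡ : ∀ u v w → ((u ++ v) −F (u ++ w)) ≈F (v −F w)
−F-cancelˡ u v w s = begin
  coeff s ((u ++ v) −F (u ++ w))                                      ≡⟨ coeff-−F s (u ++ v) (u ++ w) ⟩
  coeff s (u ++ v) ℚ.+ ℚ.- 1ℚ ℚ.* coeff s (u ++ w)
    ≡⟨ cong₂ (λ a b → a ℚ.+ ℚ.- 1ℚ ℚ.* b) (coeff-++ s u v) (coeff-++ s u w) ⟩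
  (coeff s u ℚ.+ coeff s v) ℚ.+ ℚ.- 1ℚ ℚ.* (coeff s u ℚ.+ coeff s w)
    ≡⟨ cancel (coeff s u) (coeff s v) (coeff s w) ⟩
  coeff s v ℚ.+ ℚ.- 1ℚ ℚ.* coeff s w                                  ≡⟨ coeff-−F s v w ⟨
  coeff s (v −F w)                                                    ∎
  where
  open ≡-Reasoning
  open +-*-Solver
  cancel : ∀ a b c → (a ℚ.+ b) ℚ.+ ℚ.- 1ℚ ℚ.* (a ℚ.+ c) ≡ b ℚ.+ ℚ.- 1ℚ ℚ.* c
  cancel = solve 3 (λ a b c → (a :+ b) :+ (:- con 1ℚ) :* (a :+ c) := b :+ (:- con 1ℚ) :* c) refl

span-≈ : ∀ {G} v w → v ≈F w → InSpan G w → InSpan G v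
span-≈ _ _ v≈w (xs , gens , w≈xs) = xs , gens , λ s → trans (v≈w s) (w≈xs s)

span-[] : ∀ {G} → InSpan G []
span-[] = [] , [] , λ _ → refl

span-++ : ∀ {G} v w → InSpan G v → InSpan G w → InSpan G (v ++ w)
span-++ v w (xs , gv , v≈) (ys , gw , w≈) = xs ++ ys , Allₚ.++⁺ gv gw , λ s → begin
  coeff s (v ++ w)                        ≡⟨ coeff-++ s v w ⟩
  coeff s v ℚ.+ coeff s w                 ≡⟨ cong₂ ℚ._+_ (v≈ s) (w≈ s) ⟩
  coeff s (lin xs) ℚ.+ coeff s (lin ys)   ≡⟨ coeff-++ s (lin xs) (lin ys) ⟨
  coeff s (lin xs ++ lin ys)              ≡⟨ cong (coeff s) (concatMap-++ _ xs ys) ⟨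
  coeff s (lin (xs ++ ys))                ∎
  where open ≡-Reasoning

span-scale : ∀ {G} q v → InSpan G v → InSpan G (scale q v)
span-scale q v (xs , gens , v≈) = map (Product.map₁ (q ℚ.*_)) xs , Allₚ.map⁺ gens ,
  λ s → trans (coeff-scale s q v) (trans (cong (q ℚ.*_) (v≈ s)) (sym (coeff-lin-scale s q xs)))

span-gen : ∀ {G : FC → Set} v → G v → InSpan G v
span-gen v g = (1ℚ , v) ∷ [] , g ∷ [] , λ s → sym (begin
  coeff s (scale 1ℚ v ++ [])   ≡⟨ coeff-++ s (scale 1ℚ v) [] ⟩
  coeff s (scale 1ℚ v) ℚ.+ 0ℚ  ≡⟨ ℚₚ.+-identityʳ _ ⟩
  coeff s (scale 1ℚ v)         ≡⟨ coeff-scale s 1ℚ v ⟩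
  1ℚ ℚ.* coeff s v             ≡⟨ ℚₚ.*-identityˡ _ ⟩
  coeff s v                    ∎)
  where open ≡-Reasoning

span-bind : ∀ {G H : FC → Set} → (∀ u → G u → InSpan H u) → ∀ v → InSpan G v → InSpan H v
span-bind {G} {H} G⊆H v (xs , gens , v≈) = span-≈ v (lin xs) v≈ (go xs gens)
  where
  go : ∀ xs → All (λ p → G (proj₂ p)) xs → InSpan H (lin xs)
  go []              []         = span-[]
  go ((c , u) ∷ xs) (g ∷ gens) = span-++ (scale c u) (lin xs) (span-scale c u (G⊆H u g)) (go xs gens)

span-concatMap : ∀ {G} {A : Set} (f : A → FC) xs → (∀ x → InSpan G (f x)) → InSpan G (concatMap f xs)
span-concatMap f []       _    = span-[]
span-concatMap f (x ∷ xs) f∈G = span-++ (f x) (concatMap f xs) (f∈G x) (span-concatMap f xs f∈G)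

span-term : ∀ {G : FC → Set} q s → G ⟦ s ⟧ → InSpan G ((q , s) ∷ [])
span-term q s g = span-≈ ((q , s) ∷ []) (scale q ⟦ s ⟧) (λ t → cong (ℚ._+ 0ℚ) (head (symEq t s)))
  (span-scale q ⟦ s ⟧ (span-gen ⟦ s ⟧ g))
  where
  head : ∀ b → (if b then q else 0ℚ) ≡ (if b then q ℚ.* 1ℚ else 0ℚ)
  head true  = sym (ℚₚ.*-identityʳ q)
  head false = refl

span-++-−F : ∀ {G} u v w → InSpan G u → InSpan G (v −F w) → InSpan G ((u ++ v) −F w)
span-++-−F u v w u∈G rest∈G =
  span-≈ ((u ++ v) −F w) (u ++ (v −F w)) (λ s → cong (coeff s) (++-assoc u v _))
    (span-++ u (v −F w) u∈G rest∈G)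

sub-gen : ∀ {G : FC → Set} v → G v → InSub G v
sub-gen v g = span-gen v (inj₁ g)

sub-rel : ∀ {G : FC → Set} v → Rel v → InSub G v
sub-rel v r = span-gen v (inj₂ r)

sub-bind : ∀ {G H : FC → Set} → (∀ u → G u → InSub H u) → ∀ v → InSub G v → InSub H v
sub-bind G⊆H = span-bind λ { u (inj₁ g) → G⊆H u g ; u (inj₂ r) → sub-rel u r }

symEq-cong : ∀ s {K} {X Y : RawMat K} → (∀ S → X S ≡ Y S) → symEq s (K , X) ≡ symEq s (K , Y)
symEq-cong (m , Z) {K} X≐Y with m ℕ.≟ K
... | yes refl = allL-cong (λ S → cong (λ b → does (Z S Bool.≟ b)) (X≐Y S)) (allSubsets m)
... | no  _    = refl

permutation-InSub : ∀ {G : FC → Set} {n} {M Q : RawMat n} {h : Fin n → Fin n} → IsMatroid M →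
  Enumerates h allₛ → (∀ S → Q S ≡ restrict M h S) → InSub G ⟦ n , Q ⟧ → InSub G ⟦ n , M ⟧
permutation-InSub {n = n} {M} {Q} {h} im E Q≐ Q∈G =
  span-≈ ⟦ n , M ⟧ (relation ++ scale (sgn σ) ⟦ n , Q ⟧) coefficients
    (span-++ relation (scale (sgn σ) ⟦ n , Q ⟧)
      (sub-rel relation (n , M , im , σ , refl)) (span-scale (sgn σ) ⟦ n , Q ⟧ Q∈G))
  where
  open Enumerates E
  h⁻¹ : Fin n → Fin n
  h⁻¹ j = proj₁ (onto j refl)
  σ : Permutation′ n
  σ = mk↔ₛ′ h⁻¹ h (λ x → injective (proj₂ (onto (h x) refl))) (λ j → proj₂ (onto j refl))
  relation : FC
  relation = (1ℚ , (n , M)) ∷ (ℚ.- sgn σ , (n , permute σ M)) ∷ []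
  Q≐σM : ∀ S → Q S ≡ permute σ M S
  Q≐σM S = trans (Q≐ S) (indep-cong im λ j →
    trans (cong (image h S) (sym (proj₂ (onto j refl)))) (image-apply injective S (h⁻¹ j)))
  cancel : ∀ x sg b →
    x ℚ.+ 0ℚ ≡ x ℚ.+ ((if b then ℚ.- sg else 0ℚ) ℚ.+ ((if b then sg ℚ.* 1ℚ else 0ℚ) ℚ.+ 0ℚ))
  cancel x sg true  = solve 2 (λ x sg → x :+ con 0ℚ := x :+ ((:- sg) :+ ((sg :* con 1ℚ) :+ con 0ℚ))) refl x sg
    where open +-*-Solver
  cancel x sg false = solve 1 (λ x → x :+ con 0ℚ := x :+ (con 0ℚ :+ (con 0ℚ :+ con 0ℚ))) refl x
    where open +-*-Solver
  -- [M] = ([M] − sgn σ · [σ·M]) + sgn σ · [Q], where Q and σ·M are the same symbol.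
  coefficients : ⟦ n , M ⟧ ≈F (relation ++ scale (sgn σ) ⟦ n , Q ⟧)
  coefficients s rewrite symEq-cong s Q≐σM =
    cancel (if symEq s (n , M) then 1ℚ else 0ℚ) (sgn σ) (symEq s (n , permute σ M))

relabel-InSub : ∀ {G : FC → Set} {K n} {M : RawMat n} {Q : RawMat K} {h : Fin K → Fin n} → IsMatroid M →
  Enumerates h allₛ → (∀ S → Q S ≡ restrict M h S) → InSub G ⟦ K , Q ⟧ → InSub G ⟦ n , M ⟧
relabel-InSub im E with Enumerates-allₛ⇒≡ E
... | refl = permutation-InSub im E


-- Decomposition into connected components

module Decomposition (P : Property) (sumClosed : SumClosed P) (componentInherited : ComponentInherited P)
                     {n} {M : RawMat n} (im : IsMatroid M) (pM : P M) where

  -- Q is kept apart from restrict M h because P need not respect pointwise equality of oracles.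
  record RestrictionWithP (C : Sub n) : Set where
    field
      size       : ℕ
      Q          : RawMat size
      h          : Fin size → Fin n
      enumerates : Enumerates h C
      Q≐         : ∀ S → Q S ≡ restrict M h S
      Q-P        : P Q

    open Enumerates enumerates public

    Q-isMatroid : IsMatroid Q
    Q-isMatroid = IsMatroid-≐ (restrict-isMatroid im injective) (sym ∘ Q≐)

  RestrictionWithP-cong : ∀ {C D} → C ≗ D → RestrictionWithP C → RestrictionWithP D
  RestrictionWithP-cong C≗D R = record
    { size = size ; Q = Q ; h = h ; enumerates = Enumerates-cong C≗D enumerates ; Q≐ = Q≐ ; Q-P = Q-P }
    where open RestrictionWithP R

  module _ {C₁ C₂} (sep : IsSeparator M C₁) (disjoint : ∀ j → C₂ j ≡ true → C₁ j ≡ false)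
           (R₁ : RestrictionWithP C₁) (R₂ : RestrictionWithP C₂) where
    private
      module R₁ = RestrictionWithP R₁
      module R₂ = RestrictionWithP R₂

    join-Enumerates : Enumerates (R₁.h ++ᶠ R₂.h) (C₁ ∪ₛ C₂)
    join-Enumerates = ++ᶠ-Enumerates R₁.enumerates R₂.enumerates disjoint

    join-≐ : ∀ S → (R₁.Q ⊕ R₂.Q) S ≡ restrict M (R₁.h ++ᶠ R₂.h) S
    join-≐ S = trans (cong₂ _∧_ (R₁.Q≐ _) (R₂.Q≐ _))
      (sym (restrict-++ᶠ (indep-cong im) sep R₁.into (λ j → disjoint _ (R₂.into j)) S))

    RestrictionWithP-∪ₛ : RestrictionWithP (C₁ ∪ₛ C₂)
    RestrictionWithP-∪ₛ = record
      { size = R₁.size ℕ.+ R₂.size ; Q = R₁.Q ⊕ R₂.Q ; h = R₁.h ++ᶠ R₂.h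
      ; enumerates = join-Enumerates ; Q≐ = join-≐
      ; Q-P = sumClosed R₁.Q R₂.Q R₁.Q-isMatroid R₂.Q-isMatroid R₁.Q-P R₂.Q-P
      }

  connected⇒RestrictionWithP : ∀ {C} → IsSeparator M C → (∃ λ j → C j ≡ true) →
    ¬ Disconnected (restrict M (enum C)) → RestrictionWithP C
  connected⇒RestrictionWithP {C} sep (_ , Cj) connected = record
    { size = card C ; Q = restrict M (enum C) ; h = enum C ; enumerates = E ; Q≐ = λ _ → refl
    ; Q-P = componentInherited M (enum C) im pM (Enumerates.injective E)
              (IsSeparator-cong (indep-cong im) (sym ∘ Enumerates⇒image≗ E) sep , card-pos C Cj , connected)
    }
    where
    E : Enumerates (enum C) C
    E = enum-Enumerates C

  Restrictable : Sub n → Set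
  Restrictable C = IsSeparator M C → (∃ λ j → C j ≡ true) → RestrictionWithP C

  disconnected⇒RestrictionWithP : ∀ {C} → WfRec (_<_ on card) Restrictable C → IsSeparator M C →
    Disconnected (restrict M (enum C)) → RestrictionWithP C
  disconnected⇒RestrictionWithP {C} ih sep (A , (i , Ai) , (i′ , Ai′) , sepA) =
    RestrictionWithP-cong covers (RestrictionWithP-∪ₛ sep₁ disjoint
      (ih (smaller A (cong not Ai′)) sep₁ (g i , image-intro g A Ai refl))
      (ih (smaller (not ∘ A) (trans (Boolₚ.not-involutive (A i)) Ai)) sep₂
                 (g i′ , image-intro g (not ∘ A) (cong not Ai′) refl)))
    where
    g : Fin (card C) → Fin n
    g = enum C
    E : Enumerates g C
    E = enum-Enumerates C
    open Enumerates E
    ext : Extensional (restrict M g)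
    ext = indep-cong (restrict-isMatroid im injective)
    sepG : IsSeparator M (image g allₛ)
    sepG = IsSeparator-cong (indep-cong im) (sym ∘ Enumerates⇒image≗ E) sep
    sep₁ : IsSeparator M (image g A)
    sep₁ = IsSeparator-lift im injective sepG sepA
    sep₂ : IsSeparator M (image g (not ∘ A))
    sep₂ = IsSeparator-lift im injective sepG (IsSeparator-compl ext sepA)
    smaller : ∀ B {i} → not (B i) ≡ true → card (image g B) < card C
    smaller B {i} ¬Bi = begin-strict
      card (image g B)               ≡⟨ card-image injective B ⟩
      card B                         <⟨ ℕₚ.m<m+n (card B) (card-pos (not ∘ B) ¬Bi) ⟩
      card B ℕ.+ card (not ∘ B)      ≡⟨ card-compl B ⟩
      card C                         ∎
      where open ℕₚ.≤-Reasoning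
    disjoint : ∀ j → image g (not ∘ A) j ≡ true → image g A j ≡ false
    disjoint j p with image-elim g (not ∘ A) p
    ... | i , ¬Ai , refl = trans (image-apply injective A i) (Boolₚ.not-injective ¬Ai)
    covers : image g A ∪ₛ image g (not ∘ A) ≗ C
    covers j = trans (image-∪ₛ-compl g A j) (Enumerates⇒image≗ E j)

  separator⇒RestrictionWithP : ∀ C → Restrictable C
  separator⇒RestrictionWithP = All.wfRec (On.wellFounded card <-wellFounded) _ Restrictable step
    where
    step : ∀ C → WfRec (_<_ on card) Restrictable C → Restrictable C
    step C ih sep nonempty
      with Disconnected? (indep-cong (restrict-isMatroid im (Enumerates.injective (enum-Enumerates C))))
    ... | no  connected    = connected⇒RestrictionWithP sep nonempty connected
    ... | yes disconnected = disconnected⇒RestrictionWithP ih sep disconnected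

  disconnected⇒InSub-GenProd : Disconnected M → InSub (GenProd P) ⟦ n , M ⟧
  disconnected⇒InSub-GenProd (A , (i , Ai) , (i′ , Ai′) , sep) =
    product (separator⇒RestrictionWithP A sep (i , Ai))
            (separator⇒RestrictionWithP (not ∘ A) sep′ (i′ , cong not Ai′))
    where
    sep′ : IsSeparator M (not ∘ A)
    sep′ = IsSeparator-compl (indep-cong im) sep
    disjoint : ∀ j → not (A j) ≡ true → A j ≡ false
    disjoint _ = Boolₚ.not-injective
    product : RestrictionWithP A → RestrictionWithP (not ∘ A) → InSub (GenProd P) ⟦ n , M ⟧
    product record { size = zero ; enumerates = E } _ = ⊥-elim (Finₚ.¬Fin0 (proj₁ (Enumerates.onto E i Ai)))
    product _ record { size = zero ; enumerates = E } =
      ⊥-elim (Finₚ.¬Fin0 (proj₁ (Enumerates.onto E i′ (cong not Ai′))))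
    product R₁@record { size = suc a } R₂@record { size = suc b } = relabel-InSub im
      (Enumerates-cong (λ j → Boolₚ.∨-inverseʳ (A j)) (join-Enumerates sep disjoint R₁ R₂))
      (join-≐ sep disjoint R₁ R₂)
      (sub-gen _ (a , b , R₁.Q , R₂.Q , R₁.Q-isMatroid , R₁.Q-P , R₂.Q-isMatroid , R₂.Q-P , refl))
      where
      module R₁ = RestrictionWithP R₁
      module R₂ = RestrictionWithP R₂

GenProd⊆GenDisc : ∀ {P : Property} → SumClosed P → ∀ v → GenProd P v → GenDisc P v
GenProd⊆GenDisc sumClosed _ (m , n , M , Q , iM , pM , iQ , pQ , refl) =
  suc m ℕ.+ suc n , M ⊕ Q , ⊕-isMatroid iM iQ , sumClosed M Q iM iQ pM pQ , ⊕-disconnected iM iQ , refl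

GenDisc⊆InSub-GenProd : ∀ {P : Property} → SumClosed P → ComponentInherited P →
  ∀ v → GenDisc P v → InSub (GenProd P) v
GenDisc⊆InSub-GenProd {P} sumClosed componentInherited _ (n , M , im , pM , dM , refl) =
  Decomposition.disconnected⇒InSub-GenProd (λ {k} → P {k}) sumClosed componentInherited im pM dM


-- Differentials and the identification

-- With skip = isColoop M and N = delete M (resp. isLoop M, contract M) this is ∂del ⟦ suc n , M ⟧
-- (resp. ∂con ⟦ suc n , M ⟧) unfolded.
span-∂ : ∀ {G : FC → Set} {n} (skip : Fin (suc n) → Bool) (N : Fin (suc n) → RawMat n) →
  (∀ x → skip x ≡ false → G ⟦ n , N x ⟧) →
  InSpan G (concatMap (λ x → if skip x then [] else ((1ℚ ℚ.* signF x , (n , N x)) ∷ [])) (allFin (suc n))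
            ++ [])
span-∂ {G} {n} skip N term = span-++ (concatMap summand (allFin (suc n))) []
  (span-concatMap summand (allFin (suc n)) each) span-[]
  where
  summand : Fin (suc n) → FC
  summand x = if skip x then [] else ((1ℚ ℚ.* signF x , (n , N x)) ∷ [])
  each : ∀ x → InSpan G (summand x)
  each x with skip x in skipx
  ... | true  = span-[]
  ... | false = span-term _ _ (term x skipx)

module _ {P : Property} where

  ∂del-GenP+ : DeletionClosed P → Loopless P → ∀ v → GenP+ P v → InSub (GenP+ P) (∂del v)
  ∂del-GenP+ _ loopless _ (zero , M , im , pM , refl) = span-∂ (isColoop M) (delete M) λ x nonColoop →
    ⊥-elim (Boolₚ.not-¬ (isColoop-Fin1 {x = x} im (isLoop-false {M = M} {x} (loopless M im pM x))) nonColoop)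
  ∂del-GenP+ delClosed _ _ (suc n , M , im , pM , refl) = span-∂ (isColoop M) (delete M) λ x _ →
    inj₁ (n , delete M x , delete-isMatroid im x , delClosed M im pM x , refl)

  ∂con-GenP+ : ContractionClosed P → Coloopless P → ∀ v → GenP+ P v → InSub (GenP+ P) (∂con v)
  ∂con-GenP+ _ coloopless _ (zero , M , im , pM , refl) = span-∂ (isLoop M) (contract M) λ x nonLoop →
    ⊥-elim (Boolₚ.not-¬ (isColoop-Fin1 {x = x} im (isLoop-false {M = M} {x} nonLoop)) (coloopless M im pM x))
  ∂con-GenP+ conClosed _ _ (suc n , M , im , pM , refl) = span-∂ (isLoop M) (contract M) λ x nonLoop →
    inj₁ (n , contract M x , contract-isMatroid im {x} nonLoop , conClosed M im pM x , refl)

  ∂del-GenDisc : DeletionClosed P → Loopless P → ∀ v → GenDisc P v → InSub (GenDisc P) (∂del v)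
  ∂del-GenDisc _ _ _ (zero , M , _ , _ , (_ , (() , _) , _) , refl)
  ∂del-GenDisc delClosed loopless _ (suc n , M , im , pM , dM , refl) =
    span-∂ (isColoop M) (delete M) λ x nonColoop →
    inj₁ (n , delete M x , delete-isMatroid im x , delClosed M im pM x ,
          delete-disconnected {x = x} im (loopless M im pM x) nonColoop dM , refl)

  ∂con-GenDisc : ContractionClosed P → Coloopless P → ∀ v → GenDisc P v → InSub (GenDisc P) (∂con v)
  ∂con-GenDisc _ _ _ (zero , M , _ , _ , (_ , (() , _) , _) , refl)
  ∂con-GenDisc conClosed coloopless _ (suc n , M , im , pM , dM , refl) =
    span-∂ (isLoop M) (contract M) λ x nonLoop →
    inj₁ (n , contract M x , contract-isMatroid im {x} nonLoop , conClosed M im pM x ,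
          contract-disconnected {x = x} im nonLoop (coloopless M im pM x) dM , refl)

module _ (P : Property) where

  PositivePart : FC → Set
  PositivePart v = Σ FC λ w → InSub (GenP+ P) w × InSub (GenDisc P ∪G GenP0 P) (v −F w)

  positivePart-lin : ∀ xs → All (λ p → (GenP P ∪G Rel) (proj₂ p)) xs → PositivePart (lin xs)
  positivePart-lin []             []       = [] , span-[] , span-[]
  positivePart-lin ((c , u) ∷ xs) (g ∷ gs) with positivePart-lin xs gs | g
  ... | w , w∈ , rest∈ | inj₁ (suc n , M , im , pM , refl) =
    scale c u ++ w , span-++ (scale c u) w (span-scale c u (sub-gen u (n , M , im , pM , refl))) w∈ ,
    span-≈ ((scale c u ++ lin xs) −F (scale c u ++ w)) (lin xs −F w) (−F-cancelˡ (scale c u) (lin xs) w) rest∈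
  ... | w , w∈ , rest∈ | inj₁ (zero , M , im , pM , refl) =
    w , w∈ , span-++-−F (scale c u) (lin xs) w (span-scale c u (sub-gen u (inj₂ (M , im , pM , refl)))) rest∈
  ... | w , w∈ , rest∈ | inj₂ r =
    w , w∈ , span-++-−F (scale c u) (lin xs) w (span-scale c u (sub-rel u r)) rest∈

  positivePart : ∀ v → InSub (GenP P) v → PositivePart v
  positivePart v (xs , gs , v≈) with positivePart-lin xs gs
  ... | w , w∈ , rest∈ = w , w∈ , span-≈ (v −F w) (lin xs −F w)
    (λ s → trans (coeff-−F s v w)
             (trans (cong (ℚ._+ ℚ.- 1ℚ ℚ.* coeff s w) (v≈ s)) (sym (coeff-−F s (lin xs) w))))
    rest∈

  identified : ∀ (d : FC → FC) →
    (∀ v → GenProd P v → GenDisc P v) → (∀ v → GenDisc P v → InSub (GenProd P) v) →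
    (∀ v → GenP+ P v → InSub (GenP+ P) (d v)) → (∀ v → GenDisc P v → InSub (GenDisc P) (d v)) → Identified P d
  identified d prod⊆disc disc⊆prod d-GenP+ d-GenDisc =
    d-GenP+ ,
    (λ v g → sub-bind disc⊆prod (d v) (d-GenDisc v (prod⊆disc v g))) ,
    d-GenDisc ,
    (λ v _ → sub-bind (λ u g → sub-gen u (prod⊆disc u g)) v) ,
    (λ v _ → sub-bind disc⊆prod v) ,
    positivePart

corollary5p20 : (P : Property) → IsoStable P → SumClosed P → ComponentInherited P →
    SameSub (GenDisc P) (GenProd P)
    × ((DeletionClosed P × Loopless P → Identified P ∂del)
    × (ContractionClosed P × Coloopless P → Identified P ∂con))
corollary5p20 P _ sumClosed componentInherited =
  (disc⊆prod , λ v g → sub-gen v (prod⊆disc v g)) ,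
  (λ (delClosed , loopless) → identified P ∂del prod⊆disc disc⊆prod
     (∂del-GenP+ delClosed loopless) (∂del-GenDisc delClosed loopless)) ,
  (λ (conClosed , coloopless) → identified P ∂con prod⊆disc disc⊆prod
     (∂con-GenP+ conClosed coloopless) (∂con-GenDisc conClosed coloopless))
  where
  prod⊆disc : ∀ v → GenProd P v → GenDisc P v
  prod⊆disc = GenProd⊆GenDisc sumClosed
  disc⊆prod : ∀ v → GenDisc P v → InSub (GenProd P) v
  disc⊆prod = GenDisc⊆InSub-GenProd sumClosed componentInherited
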